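{- For every integer $k\ge1$, the Beneš network of order $k$ is throughput-unlimited: it is a balancer, and for every capacity function $c:I\cup O\to[0,1]$ there is a steady-state $(t,F)$ for $(G,c)$ whose total throughput $\sum_{e\in\delta^+(I)}t(e)$ equals $\min\{c(I),c(O)\}$, where $c(I)=\sum_{i\in I}c(i)$ and $c(O)=\sum_{o\in O}c(o)$.
   Context: A splitter network is a finite directed graph $G$ with arc set $E$ whose vertex set is partitioned as $I\uplus S\uplus O$, where each input has out-degree $1$ and in-degree $0$, each output has in-degree $1$ and out-degree $0$, and each splitter has in-degree $2$ and out-degree $2$. $\delta^+(v),\delta^-(v)$ denote outgoing/incoming arcs; $\delta^+(I)$ (resp. $\delta^-(O)$) is the set of arcs leaving inputs (resp. entering outputs). A capacity function is $c:I\cup O\to[0,1]$. A steady-state for $(G,c)$ is a pair $(t,F)$ with $t:E\to[0,1]$ and $F\subseteq E$ (fluid arcs; $E\setminus F$ saturated) such that: (R3) for each input $i$ with $\delta^+(i)=\{e\}$, $t(e)\le c(i)$, and if $e\in F$ then $t(e)=c(i)$; (R4) for each output $o$ with $\delta^-(o)=\{e\}$, $t(e)\le c(o)$, and if $e\notin F$ then $t(e)=c(o)$; (R5) for each splitter $s$, $t(\delta^-(s))=t(\delta^+(s))$; (R6) for each splitter $s$ with $\delta^-(s)=\{e_1,e_2\}$ and $e_1\notin F$, $t(e_1)\ge t(e_2)$; (R7) for each splitter $s$ with $\delta^+(s)=\{e_1,e_2\}$ and $e_1\in F$, $t(e_1)\ge t(e_2)$; (R8) for arcs $uv\in E\setminus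 F$, $vw\in F$, $t(uv)=1$ or $t(vw)=1$. A splitter network is a balancer if for every $c$ with $c(o)=1$ for all outputs $o$ there is a steady-state $(t,F)$ with $t$ constant on $\delta^-(O)$. The Beneš network of order $k$ has inputs $i_j$ and outputs $o_j$ for $j\in\{0,\dots,2^k-1\}$, splitters $s_{(l,j)}$ for $l\in\{0,\dots,2k-2\}$, $j\in\{0,\dots,2^{k-1}-1\}$, arcs $i_js_{(0,\lfloor j/2\rfloor)}$ and $s_{(2k-2,\lfloor j/2\rfloor)}o_j$ for $j\in\{0,\dots,2^k-1\}$, and for each $l\in\{0,\dots,2k-3\}$ and $j\in\{0,\dots,2^{k-1}-1\}$ the arcs $s_{(l,j)}s_{(l+1,j)}$ and $s_{(l,j)}s_{(l+1,j\oplus2^{l'})}$, where $l'=\max\{k-2-l,\ l-k+1\}$ and $\oplus$ is bitwise exclusive or.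
   Formalization: The capacity functions $c$ take only rational values in $[0,1]$, and the throughputs of the steady-states are taken in ℚ as well. -}

module Defs where

open import Data.Bool using (Bool; true; false; if_then_else_)
open import Data.Nat as ℕ using (ℕ; zero; suc; _∸_; _^_; _⊔_; NonZero; z≤n; s≤s; _≡ᵇ_)
open import Data.Nat.Properties using (m^n≢0)
open import Data.Nat.DivMod using (_mod_)
open import Data.Fin using (Fin; toℕ; fromℕ; inject₁) renaming (zero to fzero; suc to fsuc)
open import Data.Fin.Properties using () renaming (_≟_ to _≟F_)
open import Data.Product using (_×_; _,_; Σ; ∃; ∃-syntax)
open import Data.Product.Properties using (≡-dec)
open import Data.Sum using (_⊎_)
open import Data.List using (List; []; _∷_; map; foldr; allFin; _++_; concatMap)
open import Data.Rational using (ℚ; 0ℚ; 1ℚ; _+_; _≤_; _⊓_)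
open import Relation.Binary.PropositionalEquality using (_≡_; _≢_)
open import Relation.Binary.Definitions using (DecidableEquality)
open import Relation.Nullary.Decidable using (⌊_⌋)

data Vtx (I S O : Set) : Set where
  inp : I → Vtx I S O
  spl : S → Vtx I S O
  out : O → Vtx I S O

-- A finite directed multigraph with vertex set I ⊎ S ⊎ O and arc type Arc.
-- The lists enumerate all inputs / outputs / arcs (each exactly once).
record Network : Set₁ where
  field
    Inp Spl Out Arc : Set
    inputs  : List Inp
    outputs : List Out
    arcs    : List Arc
    tail head : Arc → Vtx Inp Spl Out
    _≟S_ : DecidableEquality Spl

sumℚ : List ℚ → ℚ
sumℚ = foldr _+_ 0ℚ

module _ (N : Network) where
  open Network N

  isSpl : Spl → Vtx Inp Spl Out → Bool
  isSpl s (spl s') = ⌊ s ≟S s' ⌋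
  isSpl s _        = false

  isInp : Vtx Inp Spl Out → Bool
  isInp (inp _) = true
  isInp _       = false

  inFlow outFlow : (Arc → ℚ) → Spl → ℚ
  inFlow  t s = sumℚ (map (λ e → if isSpl s (head e) then t e else 0ℚ) arcs)
  outFlow t s = sumℚ (map (λ e → if isSpl s (tail e) then t e else 0ℚ) arcs)

  throughput : (Arc → ℚ) → ℚ
  throughput t = sumℚ (map (λ e → if isInp (tail e) then t e else 0ℚ) arcs)

  -- capacity function c : I ∪ O → [0,1], given as its two restrictions
  CapOK : (Inp → ℚ) → (Out → ℚ) → Set
  CapOK cI cO = (∀ i → 0ℚ ≤ cI i × cI i ≤ 1ℚ) × (∀ o → 0ℚ ≤ cO o × cO o ≤ 1ℚ)

  -- steady-state (t , F); F e ≡ true means e is fluid, false means saturated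
  record SteadyState (cI : Inp → ℚ) (cO : Out → ℚ) (t : Arc → ℚ) (F : Arc → Bool) : Set where
    field
      range : ∀ e → 0ℚ ≤ t e × t e ≤ 1ℚ
      R3 : ∀ i e → tail e ≡ inp i → t e ≤ cI i × (F e ≡ true → t e ≡ cI i)
      R4 : ∀ o e → head e ≡ out o → t e ≤ cO o × (F e ≡ false → t e ≡ cO o)
      R5 : ∀ s → inFlow t s ≡ outFlow t s
      R6 : ∀ s e₁ e₂ → e₁ ≢ e₂ → head e₁ ≡ spl s → head e₂ ≡ spl s →
           F e₁ ≡ false → t e₂ ≤ t e₁
      R7 : ∀ s e₁ e₂ → e₁ ≢ e₂ → tail e₁ ≡ spl s → tail e₂ ≡ spl s →
           F e₁ ≡ true → t e₂ ≤ t e₁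
      R8 : ∀ e₁ e₂ → head e₁ ≡ tail e₂ → F e₁ ≡ false → F e₂ ≡ true →
           t e₁ ≡ 1ℚ ⊎ t e₂ ≡ 1ℚ

  Balancer : Set
  Balancer = ∀ (cI : Inp → ℚ) → CapOK cI (λ _ → 1ℚ) →
    ∃[ t ] ∃[ F ] (SteadyState cI (λ _ → 1ℚ) t F ×
      (∀ e e′ o o′ → head e ≡ out o → head e′ ≡ out o′ → t e ≡ t e′))

  ThroughputUnlimited : Set
  ThroughputUnlimited = Balancer ×
    (∀ (cI : Inp → ℚ) (cO : Out → ℚ) → CapOK cI cO →
      ∃[ t ] ∃[ F ] (SteadyState cI cO t F ×
        throughput t ≡ (sumℚ (map cI inputs) ⊓ sumℚ (map cO outputs))))

2^-nonZero : ∀ p → NonZero (2 ^ p)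
2^-nonZero p = m^n≢0 2 p

-- j ⊕ 2^p  (bitwise exclusive or with 2^p, i.e. flip bit p of j)
xorPow2 : ℕ → ℕ → ℕ
xorPow2 j p = if (ℕ._/_ j (2 ^ p) {{2^-nonZero p}} ℕ.% 2) ≡ᵇ 0 then j ℕ.+ 2 ^ p else j ∸ 2 ^ p

-- Arcs of the Beneš network of order k = suc m:
--   inA j      : i_j → s_(0,⌊j/2⌋)
--   outA j     : s_(2k-2,⌊j/2⌋) → o_j
--   midA l j b : s_(l,j) → s_(l+1,j)          (b = false)
--                s_(l,j) → s_(l+1,j⊕2^l')     (b = true),   l ∈ {0,…,2k-3}
data BArc (m : ℕ) : Set where
  inA  : Fin (2 ^ suc m) → BArc m
  outA : Fin (2 ^ suc m) → BArc m
  midA : Fin (2 ℕ.* m) → Fin (2 ^ m) → Bool → BArc m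

module BenesDefs (m : ℕ) where
  k : ℕ
  k = suc m

  -- splitter s_(l,j): l ∈ {0,…,2k-2}, j ∈ {0,…,2^(k-1)-1}
  BSpl : Set
  BSpl = Fin (suc (2 ℕ.* m)) × Fin (2 ^ m)

  -- ⌊j/2⌋ (always < 2^(k-1); the mod only lands it in Fin)
  half : Fin (2 ^ k) → Fin (2 ^ m)
  half j = _mod_ (toℕ j ℕ./ 2) (2 ^ m) {{2^-nonZero m}}

  l′ : ℕ → ℕ
  l′ l = ((k ∸ 2) ∸ l) ⊔ ((l ℕ.+ 1) ∸ k)

  -- j ⊕ 2^(l') (always < 2^(k-1); the mod only lands it in Fin)
  cross : Fin (2 ℕ.* m) → Fin (2 ^ m) → Fin (2 ^ m)
  cross l j = _mod_ (xorPow2 (toℕ j) (l′ (toℕ l))) (2 ^ m) {{2^-nonZero m}}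

  btail bhead : BArc m → Vtx (Fin (2 ^ k)) BSpl (Fin (2 ^ k))
  btail (inA j)      = inp j
  btail (outA j)     = spl (fromℕ (2 ℕ.* m) , half j)
  btail (midA l j b) = spl (inject₁ l , j)
  bhead (inA j)          = spl (fzero , half j)
  bhead (outA j)         = out j
  bhead (midA l j false) = spl (fsuc l , j)
  bhead (midA l j true)  = spl (fsuc l , cross l j)

  barcs : List (BArc m)
  barcs = map inA (allFin _) ++ map outA (allFin _) ++
          concatMap (λ l → concatMap (λ j → midA l j false ∷ midA l j true ∷ [])
                                      (allFin _))
                    (allFin _)

Benes : (k : ℕ) → 1 ℕ.≤ k → Network
Benes (suc m) (s≤s z≤n) = record
  { Inp = Fin (2 ^ suc m) ; Spl = BSpl ; Out = Fin (2 ^ suc m) ; Arc = BArc m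
  ; inputs = allFin _ ; outputs = allFin _ ; arcs = barcs
  ; tail = btail ; head = bhead
  ; _≟S_ = ≡-dec _≟F_ _≟F_ }
  where open BenesDefs m

module Submission where

-- Write m = k - 1 and index the splitters of each of the 2m + 1 layers by bit vectors in {0,1}^m
-- (the inputs and outputs by one more, lowest, bit).  Between consecutive layers every column w is
-- joined to w and to w with one bit flipped, the flipped bit running through m - 1, …, 0 in the
-- input half and back through 0, …, m - 1 in the output half.  So a splitter at distance e from
-- the middle layer is reachable exactly from the terminals whose columns agree with its own in the
-- first e bits; call the mean capacity of those terminals its fair share.
--
-- Route 2μ through every splitter of the middle layer, where μ = min(c(I), c(O)) / 2^k, and work
-- outwards: a splitter hands its flow to its two neighbours further out by water-filling, i.e. as
-- evenly as possible subject to their fair shares.  This conserves flow at every splitter and has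
-- throughput 2^k μ, and with all output capacities 1 every output receives μ.  Declare an arc of
-- the input half fluid iff it carries its fair share, and an arc of the output half saturated iff
-- it does.  (R6) and (R7) are then properties of water-filling.  For (R8), a saturated in-arc
-- shows that the inputs do not bound the flow through its splitter and a fluid out-arc shows
-- that they do; in the middle layer one of the two fair shares equals μ because μ is a minimum.

open import Data.Fin using (Fin)
open import Data.Nat using (ℕ; suc; _^_)
open import Data.Rational using (ℚ)

open import Defs

module WaterFilling where

  open import Data.Empty using (⊥-elim)
  open import Data.Product using (∃; _,_; proj₁; proj₂)
  open import Data.Rational
  open import Data.Rational.Properties
  open import Data.Rational.Solver using (module +-*-Solver)
  open import Relation.Binary.PropositionalEquality
  open import Relation.Nullary using (yes; no; ¬_)

  open +-*-Solver

  ½*[p+p]≡p : ∀ p → ½ * (p + p) ≡ p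
  ½*[p+p]≡p = solve 1 (λ p → con ½ :* (p :+ p) := p) refl

  ½*p+½*p≡p : ∀ p → ½ * p + ½ * p ≡ p
  ½*p+½*p≡p = solve 1 (λ p → con ½ :* p :+ con ½ :* p := p) refl

  ½*p≡p-½*p : ∀ p → ½ * p ≡ p - ½ * p
  ½*p≡p-½*p = solve 1 (λ p → con ½ :* p := p :- con ½ :* p) refl

  p+q-q≡p : ∀ p q → p + q - q ≡ p
  p+q-q≡p = solve 2 (λ p q → p :+ q :- q := p) refl

  q≡p-[p-q] : ∀ p q → q ≡ p - (p - q)
  q≡p-[p-q] = solve 2 (λ p q → q := p :- (p :- q)) refl

  p+p≡q+q⇒p≡q : ∀ {p q} → p + p ≡ q + q → p ≡ q
  p+p≡q+q⇒p≡q {p} {q} eq = trans (sym (½*[p+p]≡p p)) (trans (cong (½ *_) eq) (½*[p+p]≡p q))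

  ½*-mono-≤ : ∀ {p q} → p ≤ q → ½ * p ≤ ½ * q
  ½*-mono-≤ = *-monoˡ-≤-nonNeg ½

  0≤p⇒0≤½*p : ∀ {p} → 0ℚ ≤ p → 0ℚ ≤ ½ * p
  0≤p⇒0≤½*p {p} 0≤p = subst (_≤ ½ * p) (*-zeroʳ ½) (½*-mono-≤ 0≤p)

  p≤q+q⇒½*p≤q : ∀ {p q} → p ≤ q + q → ½ * p ≤ q
  p≤q+q⇒½*p≤q {p} {q} p≤2q = subst (½ * p ≤_) (½*[p+p]≡p q) (½*-mono-≤ p≤2q)

  p≤q+r⇒p-r≤q : ∀ {p q r} → p ≤ q + r → p - r ≤ q
  p≤q+r⇒p-r≤q {p} {q} {r} le = subst (p - r ≤_) (p+q-q≡p q r) (+-monoˡ-≤ (- r) le)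

  p+q<r⇒p<r-q : ∀ {p q r} → p + q < r → p < r - q
  p+q<r⇒p<r-q {p} {q} lt = subst (_< _) (p+q-q≡p p q) (+-monoˡ-< (- q) lt)

  ≤⇒≯ : ∀ {p q} → p ≤ q → ¬ (q < p)
  ≤⇒≯ p≤q q<p = <-irrefl refl (<-≤-trans q<p p≤q)

  ≤-+-tightˡ : ∀ {a b p q} → a ≤ p → b ≤ q → a + b ≡ p + q → a ≡ p
  ≤-+-tightˡ {a} {p = p} a≤p b≤q a+b≡p+q with a <? p
  ... | yes a<p = ⊥-elim (<⇒≢ (+-mono-<-≤ a<p b≤q) a+b≡p+q)
  ... | no  a≮p = ≤-antisym a≤p (≮⇒≥ a≮p)

  -- split X p q is the part of X sent to the branch of capacity p when X is shared between
  -- branches of capacities p and q as evenly as possible (water-filling).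
  data SplitView (X p q : ℚ) : ℚ → Set where
    halves : X ≤ p + p → X ≤ q + q → SplitView X p q (½ * X)
    fill-p : p < q → p + p < X → SplitView X p q p
    fill-q : q < p → q + q < X → SplitView X p q (X - q)
    equal  : p ≡ q → SplitView X p q (½ * X)

  splitView : ∀ X p q → ∃ (SplitView X p q)
  splitView X p q with p <? q | q <? p
  ... | yes p<q | _ with X ≤? p + p
  ...   | yes X≤2p = _ , halves X≤2p (≤-trans X≤2p (<⇒≤ (+-mono-< p<q p<q)))
  ...   | no  X≰2p = _ , fill-p p<q (≰⇒> X≰2p)
  splitView X p q | no _ | yes q<p with X ≤? q + q
  ...   | yes X≤2q = _ , halves (≤-trans X≤2q (<⇒≤ (+-mono-< q<p q<p))) X≤2q
  ...   | no  X≰2q = _ , fill-q q<p (≰⇒> X≰2q)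
  splitView X p q | no p≮q | no q≮p = _ , equal (≤-antisym (≮⇒≥ q≮p) (≮⇒≥ p≮q))

  opaque
    split : ℚ → ℚ → ℚ → ℚ
    split X p q = proj₁ (splitView X p q)

    split-view : ∀ X p q → SplitView X p q (split X p q)
    split-view X p q = proj₂ (splitView X p q)

  private
    view-swap : ∀ {X p q a b} → SplitView X p q a → SplitView X q p b → b ≡ X - a
    view-swap {X} (halves _ _)    (halves _ _)    = ½*p≡p-½*p X
    view-swap {X} (halves _ _)    (equal _)       = ½*p≡p-½*p X
    view-swap {X} (equal _)       (halves _ _)    = ½*p≡p-½*p X
    view-swap {X} (equal _)       (equal _)       = ½*p≡p-½*p X
    view-swap     (fill-p _ _)    (fill-q _ _)    = refl
    view-swap {X} (fill-q _ _)    (fill-p _ _)    = q≡p-[p-q] X _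
    view-swap     (halves _ X≤2q) (fill-p _ 2q<X) = ⊥-elim (≤⇒≯ X≤2q 2q<X)
    view-swap     (halves X≤2p _) (fill-q _ 2p<X) = ⊥-elim (≤⇒≯ X≤2p 2p<X)
    view-swap     (fill-p _ 2p<X) (halves _ X≤2p) = ⊥-elim (≤⇒≯ X≤2p 2p<X)
    view-swap     (fill-q _ 2q<X) (halves X≤2q _) = ⊥-elim (≤⇒≯ X≤2q 2q<X)
    view-swap     (fill-p p<q _)  (fill-p q<p _)  = ⊥-elim (<-asym p<q q<p)
    view-swap     (fill-q q<p _)  (fill-q p<q _)  = ⊥-elim (<-asym p<q q<p)
    view-swap     (fill-p p<q _)  (equal q≡p)     = ⊥-elim (<⇒≢ p<q (sym q≡p))
    view-swap     (fill-q q<p _)  (equal q≡p)     = ⊥-elim (<⇒≢ q<p q≡p)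
    view-swap     (equal p≡q)     (fill-p q<p _)  = ⊥-elim (<⇒≢ q<p (sym p≡q))
    view-swap     (equal p≡q)     (fill-q p<q _)  = ⊥-elim (<⇒≢ p<q p≡q)

  split-swap : ∀ X p q → split X q p ≡ X - split X p q
  split-swap X p q = view-swap (split-view X p q) (split-view X q p)

  split+split-swap≡ : ∀ X p q → split X p q + split X q p ≡ X
  split+split-swap≡ X p q = begin
    split X p q + split X q p       ≡⟨ cong (split X p q +_) (split-swap X p q) ⟩
    split X p q + (X - split X p q) ≡⟨ solve 2 (λ a X → a :+ (X :- a) := X) refl (split X p q) X ⟩
    X                               ∎
    where open ≡-Reasoning

  split≤cap : ∀ {X p q} → X ≤ p + q → split X p q ≤ p
  split≤cap {X} {p} {q} X≤p+q with split X p q | split-view X p q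
  ... | _ | halves X≤2p _ = p≤q+q⇒½*p≤q X≤2p
  ... | _ | fill-p _ _    = ≤-refl
  ... | _ | fill-q _ _    = p≤q+r⇒p-r≤q X≤p+q
  ... | _ | equal refl    = p≤q+q⇒½*p≤q X≤p+q

  0≤split : ∀ {X p q} → 0ℚ ≤ X → 0ℚ ≤ p → 0ℚ ≤ q → 0ℚ ≤ split X p q
  0≤split {X} {p} {q} 0≤X 0≤p 0≤q with split X p q | split-view X p q
  ... | _ | halves _ _    = 0≤p⇒0≤½*p 0≤X
  ... | _ | fill-p _ _    = 0≤p
  ... | _ | fill-q _ 2q<X = ≤-trans 0≤q (<⇒≤ (p+q<r⇒p<r-q 2q<X))
  ... | _ | equal _       = 0≤p⇒0≤½*p 0≤X

  split-tight : ∀ {X p q} → X ≡ p + q → split X p q ≡ p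
  split-tight {X} {p} {q} X≡p+q =
    ≤-+-tightˡ (split≤cap (≤-reflexive X≡p+q))
               (split≤cap (≤-reflexive (trans X≡p+q (+-comm p q))))
               (trans (split+split-swap≡ X p q) X≡p+q)

  split-slack : ∀ {X p q} → split X p q ≢ p → split X q p ≤ split X p q
  split-slack {X} {p} {q} a≢p rewrite split-swap X p q with split X p q | split-view X p q
  ... | _ | halves _ _    = ≤-reflexive (sym (½*p≡p-½*p X))
  ... | _ | fill-p _ _    = ⊥-elim (a≢p refl)
  ... | _ | fill-q _ 2q<X = subst (_≤ X - q) (q≡p-[p-q] X q) (<⇒≤ (p+q<r⇒p<r-q 2q<X))
  ... | _ | equal _       = ≤-reflexive (sym (½*p≡p-½*p X))

  split-equalCaps : ∀ X p → split X p p ≡ ½ * X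
  split-equalCaps X p with split X p p | split-view X p p
  ... | _ | halves _ _   = refl
  ... | _ | fill-p p<p _ = ⊥-elim (<-irrefl refl p<p)
  ... | _ | fill-q p<p _ = ⊥-elim (<-irrefl refl p<p)
  ... | _ | equal _      = refl

open WaterFilling

module BooleanCube where

  open import Data.Bool using (Bool; true; false; not)
  open import Data.Bool.Properties using (not-involutive)
  open import Data.Nat using (ℕ; zero; suc)
  open import Data.Rational
  open import Data.Rational.Properties
  open import Algebra.Bundles using (CommutativeMonoid)
  open import Data.Vec using (Vec; []; _∷_)
  open import Function using (_∘_)
  open import Relation.Binary.PropositionalEquality

  open import Algebra.Properties.CommutativeSemigroup
    (CommutativeMonoid.commutativeSemigroup +-0-commutativeMonoid)
    using () renaming (interchange to +-interchange)

  flip : ∀ {n} → ℕ → Vec Bool n → Vec Bool n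
  flip _       []      = []
  flip zero    (b ∷ v) = not b ∷ v
  flip (suc p) (b ∷ v) = b ∷ flip p v

  flip-involutive : ∀ {n} p (v : Vec Bool n) → flip p (flip p v) ≡ v
  flip-involutive _       []      = refl
  flip-involutive zero    (b ∷ v) = cong (_∷ v) (not-involutive b)
  flip-involutive (suc p) (b ∷ v) = cong (b ∷_) (flip-involutive p v)

  flip-comm : ∀ {n} p q (v : Vec Bool n) → flip p (flip q v) ≡ flip q (flip p v)
  flip-comm _       _       []      = refl
  flip-comm zero    zero    (b ∷ v) = refl
  flip-comm zero    (suc q) (b ∷ v) = refl
  flip-comm (suc p) zero    (b ∷ v) = refl
  flip-comm (suc p) (suc q) (b ∷ v) = cong (b ∷_) (flip-comm p q v)

  cubeSum : ∀ {n} → (Vec Bool n → ℚ) → ℚ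
  cubeSum {zero}  g = g []
  cubeSum {suc n} g = cubeSum (g ∘ (false ∷_)) + cubeSum (g ∘ (true ∷_))

  cubeSum-cong : ∀ {n} {g h : Vec Bool n → ℚ} → (∀ v → g v ≡ h v) → cubeSum g ≡ cubeSum h
  cubeSum-cong {zero}  g≗h = g≗h []
  cubeSum-cong {suc n} g≗h =
    cong₂ _+_ (cubeSum-cong (g≗h ∘ (false ∷_))) (cubeSum-cong (g≗h ∘ (true ∷_)))

  cubeSum-distrib-+ : ∀ {n} (g h : Vec Bool n → ℚ) → cubeSum (λ v → g v + h v) ≡ cubeSum g + cubeSum h
  cubeSum-distrib-+ {zero}  g h = refl
  cubeSum-distrib-+ {suc n} g h = begin
    cubeSum (λ v → g (false ∷ v) + h (false ∷ v)) + cubeSum (λ v → g (true ∷ v) + h (true ∷ v))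
      ≡⟨ cong₂ _+_ (cubeSum-distrib-+ (g ∘ (false ∷_)) (h ∘ (false ∷_)))
                   (cubeSum-distrib-+ (g ∘ (true ∷_)) (h ∘ (true ∷_))) ⟩
    (cubeSum (g ∘ (false ∷_)) + cubeSum (h ∘ (false ∷_))) +
    (cubeSum (g ∘ (true ∷_)) + cubeSum (h ∘ (true ∷_)))
      ≡⟨ +-interchange (cubeSum (g ∘ (false ∷_))) _ _ _ ⟩
    cubeSum g + cubeSum h ∎
    where open ≡-Reasoning

  cubeSum-distribˡ-* : ∀ {n} c (g : Vec Bool n → ℚ) → cubeSum (λ v → c * g v) ≡ c * cubeSum g
  cubeSum-distribˡ-* {zero}  c g = refl
  cubeSum-distribˡ-* {suc n} c g =
    trans (cong₂ _+_ (cubeSum-distribˡ-* c (g ∘ (false ∷_))) (cubeSum-distribˡ-* c (g ∘ (true ∷_))))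
          (sym (*-distribˡ-+ c _ _))

  cubeSum-flip : ∀ {n} p (g : Vec Bool n → ℚ) → cubeSum (g ∘ flip p) ≡ cubeSum g
  cubeSum-flip {zero}  p       g = refl
  cubeSum-flip {suc n} zero    g = +-comm (cubeSum (g ∘ (true ∷_))) _
  cubeSum-flip {suc n} (suc p) g =
    cong₂ _+_ (cubeSum-flip p (g ∘ (false ∷_))) (cubeSum-flip p (g ∘ (true ∷_)))

  flipIf : ∀ {n} → Bool → ℕ → Vec Bool n → Vec Bool n
  flipIf false p v = v
  flipIf true  p v = flip p v

open BooleanCube

module PrefixMeans where

  open import Data.Bool using (Bool; true; false)
  open import Data.Nat as ℕ using (ℕ; zero; suc; s≤s)
  open import Data.Product using (_×_; _,_)
  open import Data.Rational
  open import Data.Rational.Properties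
  open import Data.Rational.Solver using (module +-*-Solver)
  open import Data.Vec using (Vec; []; _∷_)
  open import Function using (_∘_)
  open import Relation.Binary.PropositionalEquality

  open +-*-Solver

  infix 4 _∈[0,1]
  _∈[0,1] : ℚ → Set
  p ∈[0,1] = 0ℚ ≤ p × p ≤ 1ℚ

  ½*[p+q]∈[0,1] : ∀ {p q} → p ∈[0,1] → q ∈[0,1] → ½ * (p + q) ∈[0,1]
  ½*[p+q]∈[0,1] (0≤p , p≤1) (0≤q , q≤1) =
    0≤p⇒0≤½*p (+-mono-≤ 0≤p 0≤q) , p≤q+q⇒½*p≤q (+-mono-≤ p≤1 q≤1)

  ½^_ : ℕ → ℚ
  ½^ zero  = 1ℚ
  ½^ suc n = ½ * ½^ n

  0≤½^ : ∀ n → 0ℚ ≤ ½^ n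
  0≤½^ zero    = nonNegative⁻¹ 1ℚ
  0≤½^ (suc n) = 0≤p⇒0≤½*p (0≤½^ n)

  cubeSum-½^-const : ∀ n c → cubeSum {n} (λ _ → ½^ n * c) ≡ c
  cubeSum-½^-const zero    c = *-identityˡ c
  cubeSum-½^-const (suc n) c = begin
    cubeSum {n} (λ _ → ½ * ½^ n * c) + cubeSum {n} (λ _ → ½ * ½^ n * c)
      ≡⟨ cong (λ s → s + s) (cubeSum-cong {n} (λ _ → half-inside (½^ n) c)) ⟩
    cubeSum {n} (λ _ → ½^ n * (½ * c)) + cubeSum {n} (λ _ → ½^ n * (½ * c))
      ≡⟨ cong (λ s → s + s) (cubeSum-½^-const n (½ * c)) ⟩
    ½ * c + ½ * c
      ≡⟨ ½*p+½*p≡p c ⟩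
    c ∎
    where
    open ≡-Reasoning
    half-inside : ∀ x c → ½ * x * c ≡ x * (½ * c)
    half-inside = solve 2 (λ x c → con ½ :* x :* c := x :* (con ½ :* c)) refl

  mean : ∀ {n} → (Vec Bool n → ℚ) → ℚ
  mean {zero}  g = g []
  mean {suc n} g = ½ * (mean (g ∘ (false ∷_)) + mean (g ∘ (true ∷_)))

  mean≡½^*cubeSum : ∀ {n} (g : Vec Bool n → ℚ) → mean g ≡ ½^ n * cubeSum g
  mean≡½^*cubeSum {zero}  g = sym (*-identityˡ (g []))
  mean≡½^*cubeSum {suc n} g =
    trans (cong₂ (λ a b → ½ * (a + b)) (mean≡½^*cubeSum (g ∘ (false ∷_)))
                                        (mean≡½^*cubeSum (g ∘ (true ∷_))))
          (solve 3 (λ x a b → con ½ :* (x :* a :+ x :* b) := con ½ :* x :* (a :+ b)) refl (½^ n) _ _)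

  mean-∈[0,1] : ∀ {n} {g : Vec Bool n → ℚ} → (∀ v → g v ∈[0,1]) → mean g ∈[0,1]
  mean-∈[0,1] {zero}  g∈ = g∈ []
  mean-∈[0,1] {suc n} g∈ =
    ½*[p+q]∈[0,1] (mean-∈[0,1] (g∈ ∘ (false ∷_))) (mean-∈[0,1] (g∈ ∘ (true ∷_)))

  mean-const : ∀ {n} {g : Vec Bool n → ℚ} {c} → (∀ v → g v ≡ c) → mean g ≡ c
  mean-const {zero}  g≡c = g≡c []
  mean-const {suc n} {c = c} g≡c =
    trans (cong₂ (λ a b → ½ * (a + b)) (mean-const (g≡c ∘ (false ∷_))) (mean-const (g≡c ∘ (true ∷_))))
          (½*[p+p]≡p c)

  -- prefixMean e g v is the mean of g over the vectors that agree with v in the first e entries.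
  prefixMean : ∀ {n} → ℕ → (Vec Bool n → ℚ) → Vec Bool n → ℚ
  prefixMean zero    g v       = mean g
  prefixMean (suc e) g []      = g []
  prefixMean (suc e) g (b ∷ v) = prefixMean e (g ∘ (b ∷_)) v

  prefixMean-length : ∀ {n} (g : Vec Bool n → ℚ) v → prefixMean n g v ≡ g v
  prefixMean-length g []      = refl
  prefixMean-length g (b ∷ v) = prefixMean-length (g ∘ (b ∷_)) v

  prefixMean-step : ∀ {n} e (g : Vec Bool n → ℚ) v →
                    prefixMean e g v ≡ ½ * (prefixMean (suc e) g v + prefixMean (suc e) g (flip e v))
  prefixMean-step zero    g []          = sym (½*[p+p]≡p (g []))
  prefixMean-step zero    g (false ∷ v) = refl
  prefixMean-step zero    g (true ∷ v)  = cong (½ *_) (+-comm (mean (g ∘ (false ∷_))) _)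
  prefixMean-step (suc e) g []          = sym (½*[p+p]≡p (g []))
  prefixMean-step (suc e) g (b ∷ v)     = prefixMean-step e (g ∘ (b ∷_)) v

  prefixMean-double : ∀ {n} e (g : Vec Bool n → ℚ) v →
               prefixMean e g v + prefixMean e g v ≡ prefixMean (suc e) g v + prefixMean (suc e) g (flip e v)
  prefixMean-double e g v = trans (cong (λ c → c + c) (prefixMean-step e g v)) (½*p+½*p≡p _)

  prefixMean-flip : ∀ {n} {e p} (g : Vec Bool n → ℚ) v → e ℕ.≤ p →
                    prefixMean e g (flip p v) ≡ prefixMean e g v
  prefixMean-flip {e = zero}              g v       _         = refl
  prefixMean-flip {e = suc e}             g []      _         = refl
  prefixMean-flip {e = suc e} {p = suc p} g (b ∷ v) (s≤s e≤p) = prefixMean-flip (g ∘ (b ∷_)) v e≤p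

  prefixMean-∈[0,1] : ∀ {n} {g : Vec Bool n → ℚ} → (∀ v → g v ∈[0,1]) →
                      ∀ e v → prefixMean e g v ∈[0,1]
  prefixMean-∈[0,1] g∈ zero    v       = mean-∈[0,1] g∈
  prefixMean-∈[0,1] g∈ (suc e) []      = g∈ []
  prefixMean-∈[0,1] g∈ (suc e) (b ∷ v) = prefixMean-∈[0,1] (g∈ ∘ (b ∷_)) e v

  prefixMean-const : ∀ {n} {g : Vec Bool n → ℚ} {c} → (∀ v → g v ≡ c) → ∀ e v → prefixMean e g v ≡ c
  prefixMean-const g≡c zero    v       = mean-const g≡c
  prefixMean-const g≡c (suc e) []      = g≡c []
  prefixMean-const g≡c (suc e) (b ∷ v) = prefixMean-const (g≡c ∘ (b ∷_)) e v

open PrefixMeans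

module OutwardFlow where

  open import Data.Bool using (Bool; true; false; not)
  open import Data.Nat as ℕ using (ℕ; zero; suc)
  import Data.Nat.Properties as ℕₚ
  open import Data.Product using (_×_; _,_; proj₁; proj₂)
  open import Data.Rational
  open import Data.Rational.Properties
  open import Data.Vec using (Vec)
  open import Function using (_∘_)
  open import Relation.Binary.PropositionalEquality

  module _ {n} (g : Vec Bool n → ℚ) (μ : ℚ) where

    -- flow e v is the load on every arc whose outer end is the splitter in column v at distance e
    -- from the middle; the arcs from columns v and flip e v share twice that by water-filling.
    flow : ℕ → Vec Bool n → ℚ
    flow zero    v = μ
    flow (suc e) v = split (flow e v + flow e v) (prefixMean (suc e) g v) (prefixMean (suc e) g (flip e v))

    flow-flip : ∀ {e p} v → e ℕ.≤ p → flow e (flip p v) ≡ flow e v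
    flow-flip {zero}      v _   = refl
    flow-flip {suc e} {p} v e<p = cong₃ (λ X a b → split (X + X) a b)
      (flow-flip {e} v (ℕₚ.<⇒≤ e<p))
      (prefixMean-flip g v e<p)
      (trans (cong (prefixMean (suc e) g) (flip-comm e p v)) (prefixMean-flip g (flip e v) e<p))
      where
      cong₃ : ∀ (f : ℚ → ℚ → ℚ → ℚ) {a a′ b b′ c c′} →
              a ≡ a′ → b ≡ b′ → c ≡ c′ → f a b c ≡ f a′ b′ c′
      cong₃ f refl refl refl = refl

    flow-suc-flip : ∀ e v → flow (suc e) (flip e v) ≡
                    split (flow e v + flow e v) (prefixMean (suc e) g (flip e v)) (prefixMean (suc e) g v)
    flow-suc-flip e v = cong₂ (λ X b → split (X + X) (prefixMean (suc e) g (flip e v)) b)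
      (flow-flip {e} v ℕₚ.≤-refl) (cong (prefixMean (suc e) g) (flip-involutive e v))

    flow-pair : ∀ e v → flow (suc e) v + flow (suc e) (flip e v) ≡ flow e v + flow e v
    flow-pair e v = trans (cong (flow (suc e) v +_) (flow-suc-flip e v))
                          (split+split-swap≡ (flow e v + flow e v) (prefixMean (suc e) g v) _)

    flow-bounds : 0ℚ ≤ μ → μ ≤ mean g → (∀ v → g v ∈[0,1]) →
                  ∀ e v → 0ℚ ≤ flow e v × flow e v ≤ prefixMean e g v
    flow-bounds 0≤μ μ≤mean g∈ zero    v = 0≤μ , μ≤mean
    flow-bounds 0≤μ μ≤mean g∈ (suc e) v with flow-bounds 0≤μ μ≤mean g∈ e v
    ... | 0≤f , f≤cap =
      0≤split (+-mono-≤ 0≤f 0≤f) (proj₁ (prefixMean-∈[0,1] g∈ (suc e) v))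
                                 (proj₁ (prefixMean-∈[0,1] g∈ (suc e) (flip e v))) ,
      split≤cap (subst (flow e v + flow e v ≤_) (prefixMean-double e g v) (+-mono-≤ f≤cap f≤cap))

    cubeSum-flow : ∀ e → cubeSum (flow e) ≡ cubeSum {n} (λ _ → μ)
    cubeSum-flow zero    = refl
    cubeSum-flow (suc e) = trans (p+p≡q+q⇒p≡q (begin
      cubeSum next + cubeSum next                ≡⟨ cong (cubeSum next +_) (cubeSum-flip e next) ⟨
      cubeSum next + cubeSum (next ∘ flip e)     ≡⟨ cubeSum-distrib-+ next (next ∘ flip e) ⟨
      cubeSum (λ v → next v + next (flip e v))   ≡⟨ cubeSum-cong (flow-pair e) ⟩
      cubeSum (λ v → flow e v + flow e v)        ≡⟨ cubeSum-distrib-+ (flow e) (flow e) ⟩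
      cubeSum (flow e) + cubeSum (flow e)        ∎)) (cubeSum-flow e)
      where
      open ≡-Reasoning
      next : Vec Bool n → ℚ
      next = flow (suc e)

    flow-suc-flipIf : ∀ e v b → flow (suc e) (flipIf b e v) ≡
                      split (flow e v + flow e v) (prefixMean (suc e) g (flipIf b e v))
                                                  (prefixMean (suc e) g (flipIf (not b) e v))
    flow-suc-flipIf e v false = refl
    flow-suc-flipIf e v true  = flow-suc-flip e v

open OutwardFlow

module BinaryEncoding where

  open import Data.Bool using (Bool; true; false; not; if_then_else_)
  open import Data.Nat
  open import Data.Nat.Properties
  open import Data.Nat.DivMod
  open import Data.Nat.Divisibility using (n∣m*n)
  open import Data.Nat.Solver using (module +-*-Solver)
  open import Data.Fin using (Fin; toℕ; fromℕ<)
  import Data.Fin.Properties as Finₚ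
  open import Data.Vec using (Vec; []; _∷_)
  open import Function using (case_of_)
  open import Relation.Binary.PropositionalEquality

  open +-*-Solver using (solve; _:+_; _:*_; _:=_; con)

  bit : Bool → ℕ
  bit false = 0
  bit true  = 1

  -- Least significant bit first, as in half and xorPow2.
  fromBits : ∀ {n} → Vec Bool n → ℕ
  fromBits []      = 0
  fromBits (b ∷ v) = bit b + fromBits v * 2

  toBits : (n : ℕ) → ℕ → Vec Bool n
  toBits zero    x = []
  toBits (suc n) x = (x % 2 ≡ᵇ 1) ∷ toBits n (x / 2)

  [bit+y*2]/2≡y : ∀ b y → (bit b + y * 2) / 2 ≡ y
  [bit+y*2]/2≡y b y = trans (+-distrib-/-∣ʳ (bit b) (n∣m*n y)) (cong₂ _+_ (bit/2≡0 b) (m*n/n≡m y 2))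
    where
    bit/2≡0 : ∀ b → bit b / 2 ≡ 0
    bit/2≡0 false = refl
    bit/2≡0 true  = refl

  [bit+y*2]%2≡bit : ∀ b y → (bit b + y * 2) % 2 ≡ bit b
  [bit+y*2]%2≡bit b y = trans ([m+kn]%n≡m%n (bit b) y 2) (bit%2≡bit b)
    where
    bit%2≡bit : ∀ b → bit b % 2 ≡ bit b
    bit%2≡bit false = refl
    bit%2≡bit true  = refl

  bit-x%2 : ∀ x → bit (x % 2 ≡ᵇ 1) ≡ x % 2
  bit-x%2 x with x % 2 | m%n<n x 2
  ... | 0           | _                = refl
  ... | 1           | _                = refl
  ... | suc (suc _) | s≤s (s≤s ())

  toBits-fromBits : ∀ {n} (v : Vec Bool n) → toBits n (fromBits v) ≡ v
  toBits-fromBits []      = refl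
  toBits-fromBits (b ∷ v) = cong₂ _∷_
    (trans (cong (_≡ᵇ 1) ([bit+y*2]%2≡bit b (fromBits v))) (bit-≡ᵇ1 b))
    (trans (cong (toBits _) ([bit+y*2]/2≡y b (fromBits v))) (toBits-fromBits v))
    where
    bit-≡ᵇ1 : ∀ b → (bit b ≡ᵇ 1) ≡ b
    bit-≡ᵇ1 false = refl
    bit-≡ᵇ1 true  = refl

  fromBits<2^n : ∀ {n} (v : Vec Bool n) → fromBits v < 2 ^ n
  fromBits<2^n []                = s≤s z≤n
  fromBits<2^n {suc n} (b ∷ v) = begin-strict
    bit b + fromBits v * 2 ≤⟨ +-monoˡ-≤ (fromBits v * 2) (bit≤1 b) ⟩
    1 + fromBits v * 2     <⟨ n<1+n _ ⟩
    suc (fromBits v) * 2   ≤⟨ *-monoˡ-≤ 2 (fromBits<2^n v) ⟩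
    2 ^ n * 2              ≡⟨ *-comm (2 ^ n) 2 ⟩
    2 * 2 ^ n              ∎
    where
    open ≤-Reasoning
    bit≤1 : ∀ b → bit b ≤ 1
    bit≤1 false = z≤n
    bit≤1 true  = s≤s z≤n

  fromBits-toBits : ∀ n x → x < 2 ^ n → fromBits (toBits n x) ≡ x
  fromBits-toBits zero    zero    _  = refl
  fromBits-toBits zero    (suc x) (s≤s ())
  fromBits-toBits (suc n) x       x< = begin
    bit (x % 2 ≡ᵇ 1) + fromBits (toBits n (x / 2)) * 2
      ≡⟨ cong₂ (λ a b → a + b * 2) (bit-x%2 x)
               (fromBits-toBits n (x / 2) (m<n*o⇒m/o<n (subst (x <_) (*-comm 2 (2 ^ n)) x<))) ⟩
    x % 2 + x / 2 * 2
      ≡⟨ m≡m%n+[m/n]*n x 2 ⟨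
    x ∎
    where open ≡-Reasoning

  xorPow2-bit-0 : ∀ b y → xorPow2 (bit b + y * 2) 0 ≡ bit (not b) + y * 2
  xorPow2-bit-0 b y rewrite n/1≡n (bit b + y * 2) | [bit+y*2]%2≡bit b y = flip-low-bit b
    where
    flip-low-bit : ∀ b → (if bit b ≡ᵇ 0 then bit b + y * 2 + 1 else bit b + y * 2 ∸ 1) ≡ bit (not b) + y * 2
    flip-low-bit false = +-comm (y * 2) 1
    flip-low-bit true  = refl

  [bit+y*2]/2^[1+p]≡y/2^p : ∀ b y p →
    _/_ (bit b + y * 2) (2 ^ suc p) {{2^-nonZero (suc p)}} ≡ _/_ y (2 ^ p) {{2^-nonZero p}}
  [bit+y*2]/2^[1+p]≡y/2^p b y p =
    trans (sym (m/n/o≡m/[n*o] (bit b + y * 2) 2 (2 ^ p) {{_}} {{_}} {{2^-nonZero (suc p)}}))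
          (cong (_/ 2 ^ p) ([bit+y*2]/2≡y b y))
    where instance _ = 2^-nonZero p

  xorPow2-bit-suc : ∀ b y p → xorPow2 (bit b + y * 2) (suc p) ≡ bit b + xorPow2 y p * 2
  xorPow2-bit-suc b y p rewrite [bit+y*2]/2^[1+p]≡y/2^p b y p
    with _/_ y (2 ^ p) {{2^-nonZero p}} % 2 ≡ᵇ 0 in bit-p-clear
  ... | true  = solve 3 (λ a y P → a :+ y :* con 2 :+ con 2 :* P := a :+ (y :+ P) :* con 2) refl (bit b) y (2 ^ p)
  ... | false = begin
    bit b + y * 2 ∸ 2 * 2 ^ p   ≡⟨ +-∸-assoc (bit b) 2^p*2≤y*2 ⟩
    bit b + (y * 2 ∸ 2 * 2 ^ p) ≡⟨ cong (λ z → bit b + (y * 2 ∸ z)) (*-comm 2 (2 ^ p)) ⟩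
    bit b + (y * 2 ∸ 2 ^ p * 2) ≡⟨ cong (bit b +_) (*-distribʳ-∸ 2 y (2 ^ p)) ⟨
    bit b + (y ∸ 2 ^ p) * 2     ∎
    where
    open ≡-Reasoning
    instance _ = 2^-nonZero p
    2^p≤y : 2 ^ p ≤ y
    2^p≤y = m/n≢0⇒n≤m λ y/2^p≡0 →
      case trans (sym (cong (λ z → z % 2 ≡ᵇ 0) y/2^p≡0)) bit-p-clear of λ ()
    2^p*2≤y*2 : 2 * 2 ^ p ≤ y * 2
    2^p*2≤y*2 = subst (_≤ y * 2) (*-comm (2 ^ p) 2) (*-monoˡ-≤ 2 2^p≤y)

  xorPow2-fromBits : ∀ {n} (v : Vec Bool n) p → p < n → xorPow2 (fromBits v) p ≡ fromBits (flip p v)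
  xorPow2-fromBits (b ∷ v) zero    _         = xorPow2-bit-0 b (fromBits v)
  xorPow2-fromBits (b ∷ v) (suc p) (s≤s p<n) =
    trans (xorPow2-bit-suc b (fromBits v) p) (cong (λ z → bit b + z * 2) (xorPow2-fromBits v p p<n))

  finToBits : ∀ n → Fin (2 ^ n) → Vec Bool n
  finToBits n j = toBits n (toℕ j)

  bitsToFin : ∀ {n} → Vec Bool n → Fin (2 ^ n)
  bitsToFin v = fromℕ< (fromBits<2^n v)

  toℕ-bitsToFin : ∀ {n} (v : Vec Bool n) → toℕ (bitsToFin v) ≡ fromBits v
  toℕ-bitsToFin v = Finₚ.toℕ-fromℕ< (fromBits<2^n v)

  finToBits-bitsToFin : ∀ {n} (v : Vec Bool n) → finToBits n (bitsToFin v) ≡ v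
  finToBits-bitsToFin {n} v = trans (cong (toBits n) (toℕ-bitsToFin v)) (toBits-fromBits v)

  bitsToFin-finToBits : ∀ {n} (j : Fin (2 ^ n)) → bitsToFin (finToBits n j) ≡ j
  bitsToFin-finToBits {n} j =
    Finₚ.toℕ-injective (trans (toℕ-bitsToFin (finToBits n j)) (fromBits-toBits n (toℕ j) (Finₚ.toℕ<n j)))

  finToBits-injective : ∀ {n} {i j : Fin (2 ^ n)} → finToBits n i ≡ finToBits n j → i ≡ j
  finToBits-injective {n} {i} {j} eq =
    trans (sym (bitsToFin-finToBits {n} i)) (trans (cong bitsToFin eq) (bitsToFin-finToBits {n} j))

open BinaryEncoding

module FiniteSums where

  open import Data.Fin using (Fin; zero; suc; toℕ; fromℕ<)
  import Data.Fin.Properties as Finₚ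
  open import Data.List using (List; []; _∷_; map; _++_; concatMap; tabulate; allFin)
  open import Data.List.Properties using (map-++; map-tabulate; map-cong; tabulate-cong)
  open import Data.Nat as ℕ using (ℕ; _^_)
  import Data.Nat.Properties as ℕₚ
  open import Data.Rational
  open import Data.Rational.Properties
  open import Function using (_∘_; id)
  open import Relation.Binary.PropositionalEquality
  open import Relation.Nullary using (yes; no; contradiction)
  open import Algebra.Bundles using (CommutativeMonoid)
  open import Algebra.Properties.CommutativeSemigroup
    (CommutativeMonoid.commutativeSemigroup +-0-commutativeMonoid)
    using () renaming (interchange to +-interchange)

  sumℚ-++ : ∀ xs ys → sumℚ (xs ++ ys) ≡ sumℚ xs + sumℚ ys
  sumℚ-++ []       ys = sym (+-identityˡ _)
  sumℚ-++ (x ∷ xs) ys = trans (cong (x +_) (sumℚ-++ xs ys)) (sym (+-assoc x _ _))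

  variable
    A B : Set

  sumℚ-map-++ : ∀ (g : A → ℚ) xs ys → sumℚ (map g (xs ++ ys)) ≡ sumℚ (map g xs) + sumℚ (map g ys)
  sumℚ-map-++ g xs ys = trans (cong sumℚ (map-++ g xs ys)) (sumℚ-++ (map g xs) (map g ys))

  sumℚ-map-concatMap : ∀ (g : B → ℚ) (φ : A → List B) xs →
    sumℚ (map g (concatMap φ xs)) ≡ sumℚ (map (λ x → sumℚ (map g (φ x))) xs)
  sumℚ-map-concatMap g φ []       = refl
  sumℚ-map-concatMap g φ (x ∷ xs) =
    trans (sumℚ-map-++ g (φ x) (concatMap φ xs)) (cong (sumℚ (map g (φ x)) +_) (sumℚ-map-concatMap g φ xs))

  sumℚ-map-+ : ∀ (g h : A → ℚ) xs → sumℚ (map (λ x → g x + h x) xs) ≡ sumℚ (map g xs) + sumℚ (map h xs)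
  sumℚ-map-+ g h []       = sym (+-identityˡ 0ℚ)
  sumℚ-map-+ g h (x ∷ xs) =
    trans (cong (g x + h x +_) (sumℚ-map-+ g h xs)) (+-interchange (g x) (h x) _ _)

  sumℚ-map-cong : ∀ {g h : A → ℚ} → (∀ x → g x ≡ h x) → ∀ xs → sumℚ (map g xs) ≡ sumℚ (map h xs)
  sumℚ-map-cong g≗h xs = cong sumℚ (map-cong g≗h xs)

  sumℚ-map-0 : ∀ {g : A → ℚ} → (∀ x → g x ≡ 0ℚ) → ∀ xs → sumℚ (map g xs) ≡ 0ℚ
  sumℚ-map-0 g≗0 []       = refl
  sumℚ-map-0 g≗0 (x ∷ xs) = trans (cong₂ _+_ (g≗0 x) (sumℚ-map-0 g≗0 xs)) (+-identityˡ 0ℚ)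

  ∑Fin : ∀ n → (Fin n → ℚ) → ℚ
  ∑Fin n g = sumℚ (tabulate g)

  sumℚ-map-allFin : ∀ n (g : Fin n → ℚ) → sumℚ (map g (allFin n)) ≡ ∑Fin n g
  sumℚ-map-allFin n g = cong sumℚ (map-tabulate id g)

  ∑Fin-0 : ∀ n {g : Fin n → ℚ} → (∀ i → g i ≡ 0ℚ) → ∑Fin n g ≡ 0ℚ
  ∑Fin-0 n {g} g≗0 = trans (sym (sumℚ-map-allFin n g)) (sumℚ-map-0 g≗0 (allFin n))

  ∑Fin-delta : ∀ n (g : Fin n → ℚ) i₀ → (∀ i → i ≢ i₀ → g i ≡ 0ℚ) → ∑Fin n g ≡ g i₀
  ∑Fin-delta (ℕ.suc n) g zero     g≗0 =
    trans (cong (g zero +_) (∑Fin-0 n (λ i → g≗0 (suc i) (λ ())))) (+-identityʳ (g zero))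
  ∑Fin-delta (ℕ.suc n) g (suc i₀) g≗0 =
    trans (cong₂ _+_ (g≗0 zero (λ ()))
                     (∑Fin-delta n (g ∘ suc) i₀ (λ i i≢i₀ → g≗0 (suc i) (i≢i₀ ∘ Finₚ.suc-injective))))
          (+-identityˡ _)

  sumBelow : ℕ → (ℕ → ℚ) → ℚ
  sumBelow ℕ.zero    G = 0ℚ
  sumBelow (ℕ.suc n) G = G 0 + sumBelow n (G ∘ ℕ.suc)

  ∑Fin-toℕ : ∀ n (G : ℕ → ℚ) → ∑Fin n (G ∘ toℕ) ≡ sumBelow n G
  ∑Fin-toℕ ℕ.zero    G = refl
  ∑Fin-toℕ (ℕ.suc n) G = cong (G 0 +_) (∑Fin-toℕ n (G ∘ ℕ.suc))

  sumBelow-*2 : ∀ n (G : ℕ → ℚ) →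
    sumBelow (n ℕ.* 2) G ≡ sumBelow n (λ k → G (k ℕ.* 2)) + sumBelow n (λ k → G (1 ℕ.+ k ℕ.* 2))
  sumBelow-*2 ℕ.zero    G = sym (+-identityˡ 0ℚ)
  sumBelow-*2 (ℕ.suc n) G = begin
    G 0 + (G 1 + sumBelow (n ℕ.* 2) (G ∘ ℕ.suc ∘ ℕ.suc))
      ≡⟨ cong (λ s → G 0 + (G 1 + s)) (sumBelow-*2 n (G ∘ ℕ.suc ∘ ℕ.suc)) ⟩
    G 0 + (G 1 + (E + O))
      ≡⟨ cong (G 0 +_) (sym (+-assoc (G 1) E O)) ⟩
    G 0 + (G 1 + E + O)
      ≡⟨ cong (λ s → G 0 + (s + O)) (+-comm (G 1) E) ⟩
    G 0 + (E + G 1 + O)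
      ≡⟨ cong (G 0 +_) (+-assoc E (G 1) O) ⟩
    G 0 + (E + (G 1 + O))
      ≡⟨ sym (+-assoc (G 0) E (G 1 + O)) ⟩
    G 0 + E + (G 1 + O) ∎
    where
    open ≡-Reasoning
    E O : ℚ
    E = sumBelow n (λ k → G (2 ℕ.+ k ℕ.* 2))
    O = sumBelow n (λ k → G (3 ℕ.+ k ℕ.* 2))

  cubeSum-fromBits : ∀ n (G : ℕ → ℚ) → cubeSum (G ∘ fromBits {n}) ≡ sumBelow (2 ^ n) G
  cubeSum-fromBits ℕ.zero    G = sym (+-identityʳ (G 0))
  cubeSum-fromBits (ℕ.suc n) G =
    trans (cong₂ _+_ (cubeSum-fromBits n (λ k → G (k ℕ.* 2))) (cubeSum-fromBits n (λ k → G (1 ℕ.+ k ℕ.* 2))))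
          (trans (sym (sumBelow-*2 (2 ^ n) G)) (cong (λ N → sumBelow N G) (ℕₚ.*-comm (2 ^ n) 2)))

  ∑Fin≡cubeSum : ∀ n (g : Fin (2 ^ n) → ℚ) → ∑Fin (2 ^ n) g ≡ cubeSum {n} (g ∘ bitsToFin)
  ∑Fin≡cubeSum n g = begin
    ∑Fin (2 ^ n) g                     ≡⟨ cong sumℚ (tabulate-cong (λ i → sym (extend-toℕ i))) ⟩
    ∑Fin (2 ^ n) (extend ∘ toℕ)        ≡⟨ ∑Fin-toℕ (2 ^ n) extend ⟩
    sumBelow (2 ^ n) extend            ≡⟨ sym (cubeSum-fromBits n extend) ⟩
    cubeSum {n} (extend ∘ fromBits)    ≡⟨ cubeSum-cong {n} (λ v → trans (cong extend (sym (toℕ-bitsToFin v)))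
                                                                         (extend-toℕ (bitsToFin v))) ⟩
    cubeSum {n} (g ∘ bitsToFin)        ∎
    where
    open ≡-Reasoning
    extend : ℕ → ℚ
    extend k with k ℕ.<? 2 ^ n
    ... | yes k< = g (fromℕ< k<)
    ... | no  _  = 0ℚ
    extend-toℕ : ∀ i → extend (toℕ i) ≡ g i
    extend-toℕ i with toℕ i ℕ.<? 2 ^ n
    ... | yes i< = cong g (Finₚ.fromℕ<-toℕ i i<)
    ... | no  i≮ = contradiction (Finₚ.toℕ<n i) i≮

  0≤∑Fin : ∀ n {g : Fin n → ℚ} → (∀ i → 0ℚ ≤ g i) → 0ℚ ≤ ∑Fin n g
  0≤∑Fin ℕ.zero    0≤g = ≤-refl
  0≤∑Fin (ℕ.suc n) 0≤g = +-mono-≤ (0≤g zero) (0≤∑Fin n (0≤g ∘ suc))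

open FiniteSums

module BenesStructure (m : ℕ) where

  open import Data.Nat as ℕ using (zero; suc; _∸_; _⊔_; s≤s)
  open import Data.Bool using (Bool; true; false)
  open import Data.Fin using (toℕ; fromℕ; inject₁) renaming (zero to fzero; suc to fsuc)
  import Data.Fin.Properties as Finₚ
  open import Data.Fin.Relation.Unary.Top using (View; view; ‵fromℕ; ‵inject₁; view-fromℕ; view-inject₁)
  import Data.Nat.Properties as ℕₚ
  open import Data.Nat.DivMod using (m<n⇒m%n≡m; m<n*o⇒m/o<n)
  open import Data.Product using (_,_)
  open import Data.Vec as Vec using (Vec; _∷_)
  open import Relation.Binary.PropositionalEquality
  open import Relation.Nullary using (yes; no)

  open BenesDefs m

  bits : Fin (2 ^ m) → Vec Bool m
  bits = finToBits m

  lowBit : Fin (2 ^ suc m) → Bool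
  lowBit i = Vec.head (finToBits (suc m) i)

  bits-half : ∀ i → bits (half i) ≡ Vec.tail (finToBits (suc m) i)
  bits-half i = cong (toBits m) (trans (Finₚ.toℕ-fromℕ< _) (m<n⇒m%n≡m {{2^-nonZero m}} i/2<2^m))
    where
    i/2<2^m : toℕ i ℕ./ 2 ℕ.< 2 ^ m
    i/2<2^m = m<n*o⇒m/o<n (subst (toℕ i ℕ.<_) (ℕₚ.*-comm 2 (2 ^ m)) (Finₚ.toℕ<n i))

  half-bitsToFin : ∀ b w → half (bitsToFin (b ∷ w)) ≡ bitsToFin w
  half-bitsToFin b w = finToBits-injective {m} (begin
    bits (half (bitsToFin (b ∷ w)))                   ≡⟨ bits-half (bitsToFin (b ∷ w)) ⟩
    Vec.tail (finToBits (suc m) (bitsToFin (b ∷ w)))  ≡⟨ cong Vec.tail (finToBits-bitsToFin (b ∷ w)) ⟩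
    w                                                 ≡⟨ finToBits-bitsToFin w ⟨
    bits (bitsToFin w)                                ∎)
    where open ≡-Reasoning

  lowBit-bitsToFin : ∀ b (w : Vec Bool m) → lowBit (bitsToFin (b ∷ w)) ≡ b
  lowBit-bitsToFin b w = cong Vec.head (finToBits-bitsToFin (b ∷ w))

  bitsToFin-lowBit∷half : ∀ i → bitsToFin (lowBit i ∷ bits (half i)) ≡ i
  bitsToFin-lowBit∷half i =
    trans (cong (λ w → bitsToFin (lowBit i ∷ w)) (bits-half i)) (bitsToFin-finToBits {suc m} i)

  l′-firstHalf : ∀ {L} → L ℕ.< m → l′ L ≡ m ∸ suc L
  l′-firstHalf {L} L<m = begin
    (m ∸ 1 ∸ L) ⊔ (L ℕ.+ 1 ∸ suc m)  ≡⟨ cong₂ _⊔_ (ℕₚ.∸-+-assoc m 1 L)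
                                                   (cong (_∸ suc m) (ℕₚ.+-comm L 1)) ⟩
    (m ∸ suc L) ⊔ (L ∸ m)            ≡⟨ cong ((m ∸ suc L) ⊔_)
                                              (ℕₚ.m≤n⇒m∸n≡0 (ℕₚ.<⇒≤ L<m)) ⟩
    (m ∸ suc L) ⊔ 0                  ≡⟨ ℕₚ.⊔-identityʳ (m ∸ suc L) ⟩
    m ∸ suc L                        ∎
    where open ≡-Reasoning

  l′-secondHalf : ∀ {L} → m ℕ.≤ L → l′ L ≡ L ∸ m
  l′-secondHalf {L} m≤L =
    cong₂ _⊔_ (ℕₚ.m≤n⇒m∸n≡0 (ℕₚ.≤-trans (ℕₚ.m∸n≤m m 1) m≤L))
              (cong (_∸ suc m) (ℕₚ.+-comm L 1))

  l′<m : ∀ L → L ℕ.< 2 ℕ.* m → l′ L ℕ.< m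
  l′<m L L<2m with L ℕ.<? m
  ... | yes L<m = subst (ℕ._< m) (sym (l′-firstHalf L<m)) (m∸suc-L<m L<m)
    where
    m∸suc-L<m : ∀ {L} → L ℕ.< m → m ∸ suc L ℕ.< m
    m∸suc-L<m {L} (s≤s _) = s≤s (ℕₚ.m∸n≤m _ L)
  ... | no  L≮m = subst (ℕ._< m) (sym (l′-secondHalf m≤L)) (ℕₚ.+-cancelˡ-< m (L ∸ m) m (begin-strict
    m ℕ.+ (L ∸ m)  ≡⟨ ℕₚ.m+[n∸m]≡n m≤L ⟩
    L              <⟨ L<2m ⟩
    2 ℕ.* m        ≡⟨ cong (m ℕ.+_) (ℕₚ.+-identityʳ m) ⟩
    m ℕ.+ m        ∎))
    where
    open ℕₚ.≤-Reasoning
    m≤L : m ℕ.≤ L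
    m≤L = ℕₚ.≮⇒≥ L≮m

  p∸q≡suc[p∸suc[q]] : ∀ {p q} → q ℕ.< p → p ∸ q ≡ suc (p ∸ suc q)
  p∸q≡suc[p∸suc[q]] {suc p} {zero}  _         = refl
  p∸q≡suc[p∸suc[q]] {suc p} {suc q} (s≤s q<p) = p∸q≡suc[p∸suc[q]] q<p

  bits-cross : ∀ l j → bits (cross l j) ≡ flip (l′ (toℕ l)) (bits j)
  bits-cross l j = begin
    toBits m (toℕ (cross l j))                            ≡⟨ cong (toBits m) (Finₚ.toℕ-fromℕ< _) ⟩
    toBits m (xorPow2 (toℕ j) p ℕ.% 2 ^ m)                ≡⟨ cong (λ x → toBits m (xorPow2 x p ℕ.% 2 ^ m))
                                                                  j≡ ⟩
    toBits m (xorPow2 (fromBits (bits j)) p ℕ.% 2 ^ m)    ≡⟨ cong (λ x → toBits m (x ℕ.% 2 ^ m))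
                                                                  (xorPow2-fromBits (bits j) p p<m) ⟩
    toBits m (fromBits (flip p (bits j)) ℕ.% 2 ^ m)       ≡⟨ cong (toBits m)
                                                                  (m<n⇒m%n≡m (fromBits<2^n (flip p (bits j)))) ⟩
    toBits m (fromBits (flip p (bits j)))                 ≡⟨ toBits-fromBits _ ⟩
    flip p (bits j)                                       ∎
    where
    open ≡-Reasoning
    instance _ = 2^-nonZero m
    p : ℕ
    p = l′ (toℕ l)
    p<m : p ℕ.< m
    p<m = l′<m (toℕ l) (Finₚ.toℕ<n l)
    j≡ : toℕ j ≡ fromBits (bits j)
    j≡ = sym (fromBits-toBits m (toℕ j) (Finₚ.toℕ<n j))

  cross-involutive : ∀ l j → cross l (cross l j) ≡ j
  cross-involutive l j = finToBits-injective {m} (begin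
    bits (cross l (cross l j))  ≡⟨ bits-cross l (cross l j) ⟩
    flip p (bits (cross l j))   ≡⟨ cong (flip p) (bits-cross l j) ⟩
    flip p (flip p (bits j))    ≡⟨ flip-involutive p (bits j) ⟩
    bits j                      ∎)
    where
    open ≡-Reasoning
    p : ℕ
    p = l′ (toℕ l)

  headColumn : Fin (2 ℕ.* m) → Fin (2 ^ m) → Bool → Fin (2 ^ m)
  headColumn l j false = j
  headColumn l j true  = cross l j

  bhead-midA : ∀ l j b → bhead (midA l j b) ≡ spl (fsuc l , headColumn l j b)
  bhead-midA l j false = refl
  bhead-midA l j true  = refl

  headColumn-involutive : ∀ l j b → headColumn l (headColumn l j b) b ≡ j
  headColumn-involutive l j false = refl
  headColumn-involutive l j true  = cross-involutive l j

  bits-headColumn : ∀ l j b → bits (headColumn l j b) ≡ flipIf b (l′ (toℕ l)) (bits j)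
  bits-headColumn l j false = refl
  bits-headColumn l j true  = bits-cross l j

  -- The slot of an arc tells it apart from the other in-arc of its head and the other out-arc of
  -- its tail.
  slot : BArc m → Bool
  slot (inA i)      = lowBit i
  slot (outA i)     = lowBit i
  slot (midA _ _ b) = b

  inArc : BSpl → Bool → BArc m
  inArc (fzero  , j) b = inA (bitsToFin (b ∷ bits j))
  inArc (fsuc l , j) b = midA l (headColumn l j b) b

  outArc′ : ∀ {l : Fin (suc (2 ℕ.* m))} → View l → Fin (2 ^ m) → Bool → BArc m
  outArc′ ‵fromℕ       j b = outA (bitsToFin (b ∷ bits j))
  outArc′ (‵inject₁ l) j b = midA l j b

  outArc : BSpl → Bool → BArc m
  outArc (l , j) = outArc′ (view l) j

  slot-inArc : ∀ s b → slot (inArc s b) ≡ b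
  slot-inArc (fzero  , j) b = lowBit-bitsToFin b (bits j)
  slot-inArc (fsuc l , j) b = refl

  slot-outArc : ∀ s b → slot (outArc s b) ≡ b
  slot-outArc (l , j) = slot-outArc′ (view l)
    where
    slot-outArc′ : ∀ {l : Fin (suc (2 ℕ.* m))} (vl : View l) b → slot (outArc′ vl j b) ≡ b
    slot-outArc′ ‵fromℕ       b = lowBit-bitsToFin b (bits j)
    slot-outArc′ (‵inject₁ _) b = refl

  bhead-inArc : ∀ s b → bhead (inArc s b) ≡ spl s
  bhead-inArc (fzero  , j) b =
    cong (λ j′ → spl (fzero , j′)) (trans (half-bitsToFin b (bits j)) (bitsToFin-finToBits {m} j))
  bhead-inArc (fsuc l , j) b =
    trans (bhead-midA l (headColumn l j b) b) (cong (λ j′ → spl (fsuc l , j′)) (headColumn-involutive l j b))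

  btail-outArc : ∀ s b → btail (outArc s b) ≡ spl s
  btail-outArc (l , j) = btail-outArc′ (view l)
    where
    btail-outArc′ : ∀ {l : Fin (suc (2 ℕ.* m))} (vl : View l) b → btail (outArc′ vl j b) ≡ spl (l , j)
    btail-outArc′ ‵fromℕ       b =
      cong (λ j′ → spl (fromℕ _ , j′)) (trans (half-bitsToFin b (bits j)) (bitsToFin-finToBits {m} j))
    btail-outArc′ (‵inject₁ _) b = refl

  bhead≡spl⇒inArc : ∀ e s → bhead e ≡ spl s → e ≡ inArc s (slot e)
  bhead≡spl⇒inArc (inA i)          .(fzero , half i)       refl = cong inA (sym (bitsToFin-lowBit∷half i))
  bhead≡spl⇒inArc (midA l j false) .(fsuc l , j)           refl = refl
  bhead≡spl⇒inArc (midA l j true)  .(fsuc l , cross l j)   refl =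
    cong (λ j′ → midA l j′ true) (sym (cross-involutive l j))

  btail≡spl⇒outArc : ∀ e s → btail e ≡ spl s → e ≡ outArc s (slot e)
  btail≡spl⇒outArc (outA i)     .(fromℕ (2 ℕ.* m) , half i) refl rewrite view-fromℕ (2 ℕ.* m) =
    cong outA (sym (bitsToFin-lowBit∷half i))
  btail≡spl⇒outArc (midA l j b) .(inject₁ l , j)           refl rewrite view-inject₁ l = refl

  bhead≢inp : ∀ e i → bhead e ≢ inp i
  bhead≢inp (inA _)          _ ()
  bhead≢inp (outA _)         _ ()
  bhead≢inp (midA _ _ false) _ ()
  bhead≢inp (midA _ _ true)  _ ()

  bhead≡out⇒outA : ∀ e o → bhead e ≡ out o → e ≡ outA o
  bhead≡out⇒outA (outA o)         .o refl = refl
  bhead≡out⇒outA (midA _ _ false) _  ()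
  bhead≡out⇒outA (midA _ _ true)  _  ()

module ArcSums (m : ℕ) where

  open import Data.Nat as ℕ using (z≤n; s≤s)
  open import Data.Bool using (Bool; true; false; if_then_else_)
  import Data.Bool.Properties as Boolₚ
  open import Data.List using (List; []; _∷_; map; allFin; concatMap; _++_)
  open import Data.List.Properties using (map-∘)
  open import Data.Rational using (0ℚ; _+_)
  open import Data.Rational.Properties using (+-identityˡ; +-identityʳ)
  open import Function using (_∘_)
  open import Relation.Binary.PropositionalEquality
  open import Relation.Nullary using (yes; no; does; contradiction)

  open BenesStructure m
  open BenesDefs m

  ∑Arcs : (BArc m → ℚ) → ℚ
  ∑Arcs g = sumℚ (map g barcs)

  pairSum : (BArc m → ℚ) → Fin (2 ℕ.* m) → Fin (2 ^ m) → ℚ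
  pairSum g l j = g (midA l j false) + (g (midA l j true) + 0ℚ)

  ∑Mid : (BArc m → ℚ) → ℚ
  ∑Mid g = ∑Fin (2 ℕ.* m) (λ l → ∑Fin (2 ^ m) (pairSum g l))

  ∑Arcs-split : ∀ g → ∑Arcs g ≡ ∑Fin (2 ^ suc m) (g ∘ inA) + (∑Fin (2 ^ suc m) (g ∘ outA) + ∑Mid g)
  ∑Arcs-split g = begin
    sumℚ (map g (map inA terminals ++ map outA terminals ++ mids))
      ≡⟨ sumℚ-map-++ g (map inA terminals) _ ⟩
    sumℚ (map g (map inA terminals)) + sumℚ (map g (map outA terminals ++ mids))
      ≡⟨ cong (sumℚ (map g (map inA terminals)) +_) (sumℚ-map-++ g (map outA terminals) mids) ⟩
    sumℚ (map g (map inA terminals)) + (sumℚ (map g (map outA terminals)) + sumℚ (map g mids))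
      ≡⟨ cong₂ _+_ (terminalSum inA) (cong₂ _+_ (terminalSum outA) midSum) ⟩
    ∑Fin (2 ^ suc m) (g ∘ inA) + (∑Fin (2 ^ suc m) (g ∘ outA) + ∑Mid g) ∎
    where
    open ≡-Reasoning
    terminals : List (Fin (2 ^ suc m))
    terminals = allFin (2 ^ suc m)
    pair : Fin (2 ℕ.* m) → Fin (2 ^ m) → List (BArc m)
    pair l j = midA l j false ∷ midA l j true ∷ []
    layer : Fin (2 ℕ.* m) → List (BArc m)
    layer l = concatMap (pair l) (allFin (2 ^ m))
    layers : List (Fin (2 ℕ.* m))
    layers = allFin (2 ℕ.* m)
    mids : List (BArc m)
    mids = concatMap layer layers
    terminalSum : (a : Fin (2 ^ suc m) → BArc m) → sumℚ (map g (map a terminals)) ≡ ∑Fin (2 ^ suc m) (g ∘ a)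
    terminalSum a = trans (cong sumℚ (sym (map-∘ terminals))) (sumℚ-map-allFin (2 ^ suc m) (g ∘ a))
    layerSum : ∀ l → sumℚ (map g (layer l)) ≡ ∑Fin (2 ^ m) (pairSum g l)
    layerSum l = trans (sumℚ-map-concatMap g (pair l) (allFin (2 ^ m))) (sumℚ-map-allFin (2 ^ m) (pairSum g l))
    midSum : sumℚ (map g mids) ≡ ∑Mid g
    midSum = begin
      sumℚ (map g mids)                                                 ≡⟨ sumℚ-map-concatMap g layer layers ⟩
      sumℚ (map (sumℚ ∘ map g ∘ layer) layers)                          ≡⟨ sumℚ-map-cong layerSum layers ⟩
      sumℚ (map (λ l → ∑Fin (2 ^ m) (pairSum g l)) layers)              ≡⟨ sumℚ-map-allFin (2 ℕ.* m) _ ⟩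
      ∑Mid g                                                            ∎

  pairSum-0 : ∀ g l j → (∀ b → g (midA l j b) ≡ 0ℚ) → pairSum g l j ≡ 0ℚ
  pairSum-0 g l j g≗0 rewrite g≗0 false | g≗0 true = refl

  pairSum-delta : ∀ g l j b → (∀ b′ → b′ ≢ b → g (midA l j b′) ≡ 0ℚ) →
                  pairSum g l j ≡ g (midA l j b)
  pairSum-delta g l j false g≗0 rewrite g≗0 true (λ ())  = +-identityʳ _
  pairSum-delta g l j true  g≗0 rewrite g≗0 false (λ ()) = trans (+-identityˡ _) (+-identityʳ _)

  ∑Mid-0 : ∀ g → (∀ l j b → g (midA l j b) ≡ 0ℚ) → ∑Mid g ≡ 0ℚ
  ∑Mid-0 g g≗0 = ∑Fin-0 (2 ℕ.* m) (λ l → ∑Fin-0 (2 ^ m) (λ j → pairSum-0 g l j (g≗0 l j)))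

  ∑Mid-delta : ∀ g l₀ j₀ b₀ → (∀ e → e ≢ midA l₀ j₀ b₀ → g e ≡ 0ℚ) →
               ∑Mid g ≡ g (midA l₀ j₀ b₀)
  ∑Mid-delta g l₀ j₀ b₀ g≗0 = begin
    ∑Mid g                        ≡⟨ ∑Fin-delta (2 ℕ.* m) _ l₀ (λ l l≢l₀ → ∑Fin-0 (2 ^ m) (λ j →
                                       pairSum-0 g l j (λ b → g≗0 (midA l j b) (λ { refl → l≢l₀ refl })))) ⟩
    ∑Fin (2 ^ m) (pairSum g l₀)   ≡⟨ ∑Fin-delta (2 ^ m) _ j₀ (λ j j≢j₀ →
                                       pairSum-0 g l₀ j (λ b → g≗0 (midA l₀ j b) (λ { refl → j≢j₀ refl }))) ⟩
    pairSum g l₀ j₀               ≡⟨ pairSum-delta g l₀ j₀ b₀ (λ b b≢b₀ →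
                                       g≗0 (midA l₀ j₀ b) (λ { refl → b≢b₀ refl })) ⟩
    g (midA l₀ j₀ b₀)             ∎
    where open ≡-Reasoning

  ∑Arcs-delta : ∀ g x → (∀ e → e ≢ x → g e ≡ 0ℚ) → ∑Arcs g ≡ g x
  ∑Arcs-delta g x g≗0 = trans (∑Arcs-split g) (parts x g≗0)
    where
    parts : ∀ x → (∀ e → e ≢ x → g e ≡ 0ℚ) →
            ∑Fin (2 ^ suc m) (g ∘ inA) + (∑Fin (2 ^ suc m) (g ∘ outA) + ∑Mid g) ≡ g x
    parts (inA i₀) g≗0 = trans
      (cong₂ _+_ (∑Fin-delta _ _ i₀ (λ i i≢i₀ → g≗0 (inA i) λ { refl → i≢i₀ refl }))
                 (cong₂ _+_ (∑Fin-0 _ (λ i → g≗0 (outA i) (λ ())))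
                            (∑Mid-0 g (λ l j b → g≗0 (midA l j b) (λ ())))))
      (+-identityʳ _)
    parts (outA o₀) g≗0 = trans
      (cong₂ _+_ (∑Fin-0 _ (λ i → g≗0 (inA i) (λ ())))
                 (cong₂ _+_ (∑Fin-delta _ _ o₀ (λ o o≢o₀ → g≗0 (outA o) λ { refl → o≢o₀ refl }))
                            (∑Mid-0 g (λ l j b → g≗0 (midA l j b) (λ ())))))
      (trans (+-identityˡ _) (+-identityʳ _))
    parts (midA l₀ j₀ b₀) g≗0 = trans
      (cong₂ _+_ (∑Fin-0 _ (λ i → g≗0 (inA i) (λ ())))
                 (cong₂ _+_ (∑Fin-0 _ (λ o → g≗0 (outA o) (λ ()))) (∑Mid-delta g l₀ j₀ b₀ g≗0)))
      (trans (+-identityˡ _) (+-identityˡ _))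

  ∑Arcs-bySlot : ∀ g (x : Bool → BArc m) → (∀ b → slot (x b) ≡ b) →
                 (∀ e → e ≢ x (slot e) → g e ≡ 0ℚ) → ∑Arcs g ≡ g (x false) + g (x true)
  ∑Arcs-bySlot g x slot-x g≗0 = begin
    ∑Arcs g                                                  ≡⟨ sumℚ-map-cong bySlot barcs ⟩
    sumℚ (map (λ e → onSlot false e + onSlot true e) barcs)  ≡⟨ sumℚ-map-+ (onSlot false) (onSlot true) barcs ⟩
    ∑Arcs (onSlot false) + ∑Arcs (onSlot true)               ≡⟨ cong₂ _+_ (∑Arcs-delta _ (x false) (onSlot-0 false))
                                                                         (∑Arcs-delta _ (x true) (onSlot-0 true)) ⟩
    onSlot false (x false) + onSlot true (x true)            ≡⟨ cong₂ _+_ (onSlot-x false) (onSlot-x true) ⟩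
    g (x false) + g (x true)                                 ∎
    where
    open ≡-Reasoning
    onSlot : Bool → BArc m → ℚ
    onSlot b e = if does (slot e Boolₚ.≟ b) then g e else 0ℚ
    bySlot : ∀ e → g e ≡ onSlot false e + onSlot true e
    bySlot e with slot e
    ... | false = sym (+-identityʳ (g e))
    ... | true  = sym (+-identityˡ (g e))
    onSlot-0 : ∀ b e → e ≢ x b → onSlot b e ≡ 0ℚ
    onSlot-0 b e e≢xb with slot e Boolₚ.≟ b
    ... | yes refl = g≗0 e e≢xb
    ... | no  _    = refl
    onSlot-x : ∀ b → onSlot b (x b) ≡ g (x b)
    onSlot-x b with slot (x b) Boolₚ.≟ b
    ... | yes _      = refl
    ... | no  slot≢b = contradiction (slot-x b) slot≢b

  N : Network
  N = Benes (suc m) (s≤s z≤n)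

  isSpl-true : ∀ s v → isSpl N s v ≡ true → v ≡ spl s
  isSpl-true s (spl s′) eq with Network._≟S_ N s s′
  ... | yes refl = refl

  isSpl-spl : ∀ s → isSpl N s (spl s) ≡ true
  isSpl-spl s with Network._≟S_ N s s
  ... | yes _   = refl
  ... | no  s≢s = contradiction refl s≢s

  inFlow-inArc : ∀ t s → inFlow N t s ≡ t (inArc s false) + t (inArc s true)
  inFlow-inArc t s =
    trans (∑Arcs-bySlot g (inArc s) (slot-inArc s) g≗0) (cong₂ _+_ (g-inArc false) (g-inArc true))
    where
    g : BArc m → ℚ
    g e = if isSpl N s (bhead e) then t e else 0ℚ
    g≗0 : ∀ e → e ≢ inArc s (slot e) → g e ≡ 0ℚ
    g≗0 e e≢ with isSpl N s (bhead e) in eq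
    ... | true  = contradiction (bhead≡spl⇒inArc e s (isSpl-true s (bhead e) eq)) e≢
    ... | false = refl
    g-inArc : ∀ b → g (inArc s b) ≡ t (inArc s b)
    g-inArc b rewrite bhead-inArc s b | isSpl-spl s = refl

  outFlow-outArc : ∀ t s → outFlow N t s ≡ t (outArc s false) + t (outArc s true)
  outFlow-outArc t s =
    trans (∑Arcs-bySlot g (outArc s) (slot-outArc s) g≗0) (cong₂ _+_ (g-outArc false) (g-outArc true))
    where
    g : BArc m → ℚ
    g e = if isSpl N s (btail e) then t e else 0ℚ
    g≗0 : ∀ e → e ≢ outArc s (slot e) → g e ≡ 0ℚ
    g≗0 e e≢ with isSpl N s (btail e) in eq
    ... | true  = contradiction (btail≡spl⇒outArc e s (isSpl-true s (btail e) eq)) e≢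
    ... | false = refl
    g-outArc : ∀ b → g (outArc s b) ≡ t (outArc s b)
    g-outArc b rewrite btail-outArc s b | isSpl-spl s = refl

  throughput-inA : ∀ t → throughput N t ≡ ∑Fin (2 ^ suc m) (t ∘ inA)
  throughput-inA t = begin
    throughput N t                                             ≡⟨ ∑Arcs-split g ⟩
    ∑Fin _ (t ∘ inA) + (∑Fin (2 ^ suc m) (g ∘ outA) + ∑Mid g)  ≡⟨ cong (∑Fin _ (t ∘ inA) +_)
                                                                     (cong₂ _+_ (∑Fin-0 (2 ^ suc m) {g ∘ outA} (λ _ → refl))
                                                                                (∑Mid-0 g (λ _ _ _ → refl))) ⟩
    ∑Fin _ (t ∘ inA) + (0ℚ + 0ℚ)                               ≡⟨ +-identityʳ _ ⟩
    ∑Fin _ (t ∘ inA)                                           ∎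
    where
    open ≡-Reasoning
    g : BArc m → ℚ
    g e = if isInp N (btail e) then t e else 0ℚ

module Terminals {m : ℕ} (c : Fin (2 ^ suc m) → ℚ) (c∈ : ∀ i → c i ∈[0,1]) (μ : ℚ) where

  open import Data.Nat using (zero)
  open import Data.Bool using (Bool; true; false; not)
  open import Data.Product using (_×_; _,_; proj₁; proj₂)
  open import Data.Rational
  open import Data.Rational.Properties
  open import Data.Rational.Solver using (module +-*-Solver)
  open import Data.Vec using (Vec; _∷_)
  open import Function using (_∘_)
  open import Relation.Binary.PropositionalEquality

  open +-*-Solver

  terminalCap : Vec Bool (suc m) → ℚ
  terminalCap v = c (bitsToFin v)

  pairCap : Vec Bool m → ℚ
  pairCap w = ½ * (terminalCap (false ∷ w) + terminalCap (true ∷ w))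

  fairShare : ℕ → Vec Bool m → ℚ
  fairShare e = prefixMean e pairCap

  load : ℕ → Vec Bool m → ℚ
  load = flow pairCap μ

  terminalLoad : Vec Bool (suc m) → ℚ
  terminalLoad (b ∷ w) = split (load m w + load m w) (terminalCap (b ∷ w)) (terminalCap (not b ∷ w))

  pairCap∈ : ∀ w → pairCap w ∈[0,1]
  pairCap∈ w = ½*[p+q]∈[0,1] (c∈ _) (c∈ _)

  fairShare∈ : ∀ e w → fairShare e w ∈[0,1]
  fairShare∈ = prefixMean-∈[0,1] pairCap∈

  fairShare-length-double : ∀ w → fairShare m w + fairShare m w ≡ terminalCap (false ∷ w) + terminalCap (true ∷ w)
  fairShare-length-double w = trans (cong (λ x → x + x) (prefixMean-length pairCap w)) (½*p+½*p≡p _)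

  mean-pairCap : mean pairCap ≡ ½^ (suc m) * ∑Fin (2 ^ suc m) c
  mean-pairCap = begin
    mean pairCap                                ≡⟨ mean≡½^*cubeSum pairCap ⟩
    ½^ m * cubeSum pairCap                      ≡⟨ cong (½^ m *_) (cubeSum-distribˡ-* ½ capSum) ⟩
    ½^ m * (½ * cubeSum capSum)                 ≡⟨ cong (λ s → ½^ m * (½ * s))
                                                        (cubeSum-distrib-+ (terminalCap ∘ (false ∷_))
                                                                           (terminalCap ∘ (true ∷_))) ⟩
    ½^ m * (½ * cubeSum terminalCap)            ≡⟨ solve 2 (λ x s → x :* (con ½ :* s) := con ½ :* x :* s) refl
                                                         (½^ m) _ ⟩
    ½^ (suc m) * cubeSum terminalCap            ≡⟨ cong (½^ (suc m) *_) (∑Fin≡cubeSum (suc m) c) ⟨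
    ½^ (suc m) * ∑Fin (2 ^ suc m) c             ∎
    where
    open ≡-Reasoning
    capSum : Vec Bool m → ℚ
    capSum w = terminalCap (false ∷ w) + terminalCap (true ∷ w)

  terminalLoad-pair : ∀ w → terminalLoad (false ∷ w) + terminalLoad (true ∷ w) ≡ load m w + load m w
  terminalLoad-pair w = split+split-swap≡ (load m w + load m w) (terminalCap (false ∷ w)) _

  cubeSum-terminalLoad : cubeSum terminalLoad ≡ cubeSum {m} (λ _ → μ) + cubeSum {m} (λ _ → μ)
  cubeSum-terminalLoad = begin
    cubeSum terminalLoad                           ≡⟨ cubeSum-distrib-+ (terminalLoad ∘ (false ∷_))
                                                                        (terminalLoad ∘ (true ∷_)) ⟨
    cubeSum (λ w → terminalLoad (false ∷ w) + terminalLoad (true ∷ w))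
                                                   ≡⟨ cubeSum-cong terminalLoad-pair ⟩
    cubeSum (λ w → load m w + load m w)            ≡⟨ cubeSum-distrib-+ (load m) (load m) ⟩
    cubeSum (load m) + cubeSum (load m)            ≡⟨ cong (λ s → s + s) (cubeSum-flow pairCap μ m) ⟩
    cubeSum {m} (λ _ → μ) + cubeSum {m} (λ _ → μ)  ∎
    where open ≡-Reasoning

  module Bounded (0≤μ : 0ℚ ≤ μ) (μ≤ : μ ≤ ½^ (suc m) * ∑Fin (2 ^ suc m) c) where

    load-bounds : ∀ e w → 0ℚ ≤ load e w × load e w ≤ fairShare e w
    load-bounds = flow-bounds pairCap μ 0≤μ (subst (μ ≤_) (sym mean-pairCap) μ≤) pairCap∈

    terminalLoad-bounds : ∀ v → 0ℚ ≤ terminalLoad v × terminalLoad v ≤ terminalCap v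
    terminalLoad-bounds (b ∷ w) = 0≤split 0≤2load (proj₁ (c∈ _)) (proj₁ (c∈ _)) , split≤cap (2load≤ b)
      where
      0≤2load : 0ℚ ≤ load m w + load m w
      0≤2load = +-mono-≤ (proj₁ (load-bounds m w)) (proj₁ (load-bounds m w))
      2load≤ : ∀ b → load m w + load m w ≤ terminalCap (b ∷ w) + terminalCap (not b ∷ w)
      2load≤ false = subst (load m w + load m w ≤_) (fairShare-length-double w)
                           (+-mono-≤ (proj₂ (load-bounds m w)) (proj₂ (load-bounds m w)))
      2load≤ true  = subst (load m w + load m w ≤_) (+-comm (terminalCap (false ∷ w)) _) (2load≤ false)

  module AllOne (c≡1 : ∀ i → c i ≡ 1ℚ) where

    split-μ : split (μ + μ) 1ℚ 1ℚ ≡ μ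
    split-μ = trans (split-equalCaps (μ + μ) 1ℚ) (½*[p+p]≡p μ)

    fairShare≡1 : ∀ e w → fairShare e w ≡ 1ℚ
    fairShare≡1 =
      prefixMean-const (λ w → trans (cong₂ (λ a b → ½ * (a + b)) (c≡1 _) (c≡1 _)) (½*[p+p]≡p 1ℚ))

    load≡μ : ∀ e w → load e w ≡ μ
    load≡μ zero    w = refl
    load≡μ (suc e) w rewrite fairShare≡1 (suc e) w | fairShare≡1 (suc e) (flip e w) | load≡μ e w = split-μ

    terminalLoad≡μ : ∀ v → terminalLoad v ≡ μ
    terminalLoad≡μ (b ∷ w)
      rewrite c≡1 (bitsToFin (b ∷ w)) | c≡1 (bitsToFin (not b ∷ w)) | load≡μ m w = split-μ

module SteadyStateConstruction (m : ℕ) (cI cO : Fin (2 ^ suc m) → ℚ)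
    (cI∈ : ∀ i → cI i ∈[0,1]) (cO∈ : ∀ o → cO o ∈[0,1]) where

  open import Data.Nat as ℕ using (_∸_; z≤n; s≤s)
  open import Data.Bool using (Bool; true; false; not)
  open import Data.Bool.Properties using (¬-not)
  open import Data.Empty using (⊥; ⊥-elim)
  open import Data.Fin using (toℕ; fromℕ) renaming (zero to fzero; suc to fsuc)
  import Data.Fin.Properties as Finₚ
  open import Data.Fin.Relation.Unary.Top using (View; view; ‵fromℕ; ‵inject₁)
  open import Data.List using (map; allFin)
  import Data.Nat.Properties as ℕₚ
  open import Data.Product using (_×_; _,_; proj₁; proj₂)
  open import Data.Rational
  open import Data.Rational.Properties
  open import Data.Rational.Solver using (module +-*-Solver)
  open import Data.Sum using (_⊎_; inj₁; inj₂; [_,_]′)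
  open import Data.Vec using (Vec; _∷_)
  open import Function using (_∘_)
  open import Relation.Binary.PropositionalEquality
  open import Relation.Nullary using (¬_; yes; no; does; contradiction)

  open BenesStructure m
  open ArcSums m
  open BenesDefs m
  open +-*-Solver

  M : ℚ
  M = ∑Fin (2 ^ suc m) cI ⊓ ∑Fin (2 ^ suc m) cO

  μ : ℚ
  μ = ½^ (suc m) * M

  module In  = Terminals {m} cI cI∈ μ
  module Out = Terminals {m} cO cO∈ μ

  ½^-mono-≤ : ∀ {p q} → p ≤ q → ½^ (suc m) * p ≤ ½^ (suc m) * q
  ½^-mono-≤ = *-monoˡ-≤-nonNeg (½^ (suc m)) {{nonNegative (0≤½^ (suc m))}}

  0≤μ : 0ℚ ≤ μ
  0≤μ = subst (_≤ μ) (*-zeroʳ (½^ (suc m)))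
              (½^-mono-≤ (⊓-glb (0≤∑Fin _ (proj₁ ∘ cI∈)) (0≤∑Fin _ (proj₁ ∘ cO∈))))

  module InBounds  = In.Bounded  0≤μ (½^-mono-≤ (p⊓q≤p (∑Fin (2 ^ suc m) cI) (∑Fin (2 ^ suc m) cO)))
  module OutBounds = Out.Bounded 0≤μ (½^-mono-≤ (p⊓q≤q (∑Fin (2 ^ suc m) cI) (∑Fin (2 ^ suc m) cO)))

  μ≡fairShare₀ : ∀ w → μ ≡ In.fairShare 0 w ⊎ μ ≡ Out.fairShare 0 w
  μ≡fairShare₀ w with ⊓-sel (∑Fin (2 ^ suc m) cI) (∑Fin (2 ^ suc m) cO)
  ... | inj₁ M≡∑cI = inj₁ (trans (cong (½^ (suc m) *_) M≡∑cI) (sym In.mean-pairCap))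
  ... | inj₂ M≡∑cO = inj₂ (trans (cong (½^ (suc m) *_) M≡∑cO) (sym Out.mean-pairCap))

  data Half : Set where
    inputHalf outputHalf : Half

  record ArcData : Set where
    constructor arcData
    field
      halfOf   : Half
      value    : ℚ
      capacity : ℚ

  inputData outputData : ℕ → Vec Bool m → ArcData
  inputData  e w = arcData inputHalf  (In.load e w)  (In.fairShare e w)
  outputData e w = arcData outputHalf (Out.load e w) (Out.fairShare e w)

  midData : Fin (2 ℕ.* m) → Fin (2 ^ m) → Bool → ArcData
  midData l j b with toℕ l ℕ.<? m
  ... | yes _ = inputData (m ∸ toℕ l) (bits j)
  ... | no  _ = outputData (suc (toℕ l ∸ m)) (bits (headColumn l j b))

  midData-firstHalf : ∀ {l} j b → toℕ l ℕ.< m → midData l j b ≡ inputData (m ∸ toℕ l) (bits j)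
  midData-firstHalf {l} j b L<m with toℕ l ℕ.<? m
  ... | yes _   = refl
  ... | no  L≮m = contradiction L<m L≮m

  midData-secondHalf : ∀ {l} j b → m ℕ.≤ toℕ l →
                       midData l j b ≡ outputData (suc (toℕ l ∸ m)) (bits (headColumn l j b))
  midData-secondHalf {l} j b m≤L with toℕ l ℕ.<? m
  ... | yes L<m = contradiction m≤L (ℕₚ.<⇒≱ L<m)
  ... | no  _   = refl

  arc : BArc m → ArcData
  arc (inA i)      = arcData inputHalf  (In.terminalLoad  (finToBits (suc m) i)) (cI i)
  arc (outA o)     = arcData outputHalf (Out.terminalLoad (finToBits (suc m) o)) (cO o)
  arc (midA l j b) = midData l j b

  t : BArc m → ℚ
  t e = ArcData.value (arc e)

  -- Chosen to agree with (R3) and (R4) at the terminals.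
  fluid : Half → ℚ → ℚ → Bool
  fluid inputHalf  a κ = does (a ≟ κ)
  fluid outputHalf a κ = not (does (a ≟ κ))

  isFluid : BArc m → Bool
  isFluid e = fluid (ArcData.halfOf (arc e)) (t e) (ArcData.capacity (arc e))

  isFluid-arc : ∀ e {h a κ} → arc e ≡ arcData h a κ → isFluid e ≡ fluid h a κ
  isFluid-arc e arc-e rewrite arc-e = refl

  fluid-input-false : ∀ {a κ} → fluid inputHalf a κ ≡ false → a ≢ κ
  fluid-input-false {a} {κ} eq with a ≟ κ | eq
  ... | no a≢κ | _ = a≢κ

  fluid-input-true : ∀ {a κ} → fluid inputHalf a κ ≡ true → a ≡ κ
  fluid-input-true {a} {κ} eq with a ≟ κ | eq
  ... | yes a≡κ | _ = a≡κ

  fluid-output-true : ∀ {a κ} → fluid outputHalf a κ ≡ true → a ≢ κ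
  fluid-output-true {a} {κ} eq with a ≟ κ | eq
  ... | no a≢κ | _ = a≢κ

  fluid-output-false : ∀ {a κ} → fluid outputHalf a κ ≡ false → a ≡ κ
  fluid-output-false {a} {κ} eq with a ≟ κ | eq
  ... | yes a≡κ | _ = a≡κ

  splitterFlow : ℕ → Vec Bool m → ℚ
  splitterFlow L w with L ℕ.≤? m
  ... | yes _ = In.load (m ∸ L) w + In.load (m ∸ L) w
  ... | no  _ = Out.load (L ∸ m) w + Out.load (L ∸ m) w

  splitterFlow-firstHalf : ∀ {L} w → L ℕ.≤ m → splitterFlow L w ≡ In.load (m ∸ L) w + In.load (m ∸ L) w
  splitterFlow-firstHalf {L} w L≤m with L ℕ.≤? m
  ... | yes _   = refl
  ... | no  L≰m = contradiction L≤m L≰m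

  splitterFlow-secondHalf : ∀ {L} w → m ℕ.≤ L → splitterFlow L w ≡ Out.load (L ∸ m) w + Out.load (L ∸ m) w
  splitterFlow-secondHalf {L} w m≤L with L ℕ.≤? m
  ... | no  _   = refl
  ... | yes L≤m = trans (cong (λ e → In.load e w + In.load e w) (ℕₚ.m≤n⇒m∸n≡0 m≤L))
                        (cong (λ e → Out.load e w + Out.load e w) (sym (ℕₚ.m≤n⇒m∸n≡0 L≤m)))

  -- The inputs bound the flow through splitter (L, w): it reaches the input fair share or misses
  -- the output one.
  data InputLimited (L : ℕ) (w : Vec Bool m) : Set where
    inputTight  : L ℕ.< m → splitterFlow L w ≡ In.fairShare (m ∸ L) w + In.fairShare (m ∸ L) w →
                  InputLimited L w
    outputSlack : m ℕ.≤ L → splitterFlow L w ≢ Out.fairShare (L ∸ m) w + Out.fairShare (L ∸ m) w →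
                  InputLimited L w

  ¬InputLimited-firstHalf : ∀ {L w} → L ℕ.≤ m →
    splitterFlow L w ≢ In.fairShare (m ∸ L) w + In.fairShare (m ∸ L) w → ¬ InputLimited L w
  ¬InputLimited-firstHalf _ slack (inputTight _ tight) = slack tight
  ¬InputLimited-firstHalf {L} {w} L≤m slack (outputSlack m≤L slack′) =
    [ slack ∘ middle In.fairShare (ℕₚ.m≤n⇒m∸n≡0 m≤L) , slack′ ∘ middle Out.fairShare (ℕₚ.m≤n⇒m∸n≡0 L≤m) ]′
      (μ≡fairShare₀ w)
    where
    middle : ∀ (share : ℕ → Vec Bool m → ℚ) {e} → e ≡ 0 → μ ≡ share 0 w →
             splitterFlow L w ≡ share e w + share e w
    middle share e≡0 μ≡share₀ = begin
      splitterFlow L w                       ≡⟨ splitterFlow-firstHalf w L≤m ⟩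
      In.load (m ∸ L) w + In.load (m ∸ L) w  ≡⟨ cong (λ e → In.load e w + In.load e w) (ℕₚ.m≤n⇒m∸n≡0 m≤L) ⟩
      μ + μ                                  ≡⟨ cong (λ x → x + x)
                                                     (trans μ≡share₀ (cong (λ e → share e w) (sym e≡0))) ⟩
      share _ w + share _ w                  ∎
      where open ≡-Reasoning

  ¬InputLimited-secondHalf : ∀ {L w} → m ℕ.< L →
    splitterFlow L w ≡ Out.fairShare (L ∸ m) w + Out.fairShare (L ∸ m) w → ¬ InputLimited L w
  ¬InputLimited-secondHalf m<L _     (inputTight L<m _)    = ℕₚ.<-asym m<L L<m
  ¬InputLimited-secondHalf _   tight (outputSlack _ slack) = slack tight

  record IncomingPair (x : Bool → BArc m) (L : ℕ) (w : Vec Bool m) : Set where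
    field
      sum                : t (x false) + t (x true) ≡ splitterFlow L w
      saturated⇒≥        : ∀ b → isFluid (x b) ≡ false → t (x (not b)) ≤ t (x b)
      saturated⇒¬limited : ∀ b → isFluid (x b) ≡ false → ¬ InputLimited L w

  record OutgoingPair (x : Bool → BArc m) (L : ℕ) (w : Vec Bool m) : Set where
    field
      sum           : t (x false) + t (x true) ≡ splitterFlow L w
      fluid⇒≥       : ∀ b → isFluid (x b) ≡ true → t (x (not b)) ≤ t (x b)
      fluid⇒limited : ∀ b → isFluid (x b) ≡ true → InputLimited L w

  module SplitPair {x : Bool → BArc m} {h X} (p : Bool → ℚ)
                   (arc-x : ∀ b → arc (x b) ≡ arcData h (split X (p b) (p (not b))) (p b)) where

    t-x : ∀ b → t (x b) ≡ split X (p b) (p (not b))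
    t-x b = cong ArcData.value (arc-x b)

    sum : t (x false) + t (x true) ≡ X
    sum = trans (cong₂ _+_ (t-x false) (t-x true)) (split+split-swap≡ X (p false) (p true))

    slack⇒≥ : ∀ b → t (x b) ≢ p b → t (x (not b)) ≤ t (x b)
    slack⇒≥ false slack =
      subst₂ _≤_ (sym (t-x true)) (sym (t-x false)) (split-slack (slack ∘ trans (t-x false)))
    slack⇒≥ true  slack =
      subst₂ _≤_ (sym (t-x false)) (sym (t-x true)) (split-slack (slack ∘ trans (t-x true)))

    slack⇒≢capacitySum : ∀ b → t (x b) ≢ p b → X ≢ p false + p true
    slack⇒≢capacitySum false slack tight = slack (trans (t-x false) (split-tight tight))
    slack⇒≢capacitySum true  slack tight =
      slack (trans (t-x true) (split-tight (trans tight (+-comm (p false) (p true)))))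

  module EqualPair {x : Bool → BArc m} {h a κ} (arc-x : ∀ b → arc (x b) ≡ arcData h a κ) where

    t-x : ∀ b → t (x b) ≡ a
    t-x b = cong ArcData.value (arc-x b)

    sum : t (x false) + t (x true) ≡ a + a
    sum = cong₂ _+_ (t-x false) (t-x true)

    ordered : ∀ b → t (x (not b)) ≤ t (x b)
    ordered b = ≤-reflexive (trans (t-x (not b)) (sym (t-x b)))

    tight : ∀ b → t (x b) ≡ κ → a + a ≡ κ + κ
    tight b eq = cong (λ y → y + y) (trans (sym (t-x b)) eq)

  incomingPair-split : ∀ {x L w X} (p : Bool → ℚ) → L ℕ.≤ m → splitterFlow L w ≡ X →
    p false + p true ≡ In.fairShare (m ∸ L) w + In.fairShare (m ∸ L) w →
    (∀ b → arc (x b) ≡ arcData inputHalf (split X (p b) (p (not b))) (p b)) → IncomingPair x L w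
  incomingPair-split {x} p L≤m flow≡X caps arc-x = record
    { sum                = trans P.sum (sym flow≡X)
    ; saturated⇒≥        = λ b sat → P.slack⇒≥ b (slack b sat)
    ; saturated⇒¬limited = λ b sat → ¬InputLimited-firstHalf L≤m λ tight →
        P.slack⇒≢capacitySum b (slack b sat) (trans (sym flow≡X) (trans tight (sym caps)))
    }
    where
    module P = SplitPair {x} p arc-x
    slack : ∀ b → isFluid (x b) ≡ false → t (x b) ≢ p b
    slack b sat = fluid-input-false (trans (sym (isFluid-arc (x b) (arc-x b))) sat) ∘ trans (sym (P.t-x b))

  incomingPair-equal : ∀ {x L w a κ} → m ℕ.< L → splitterFlow L w ≡ a + a → κ ≡ Out.fairShare (L ∸ m) w →
    (∀ b → arc (x b) ≡ arcData outputHalf a κ) → IncomingPair x L w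
  incomingPair-equal {x} {a = a} {κ} m<L flow≡2a κ≡share arc-x = record
    { sum                = trans P.sum (sym flow≡2a)
    ; saturated⇒≥        = λ b _ → P.ordered b
    ; saturated⇒¬limited = λ b sat → ¬InputLimited-secondHalf m<L
        (trans flow≡2a (trans (P.tight b (tight b sat)) (cong (λ y → y + y) κ≡share)))
    }
    where
    module P = EqualPair {x} arc-x
    tight : ∀ b → isFluid (x b) ≡ false → t (x b) ≡ κ
    tight b sat = trans (P.t-x b) (fluid-output-false (trans (sym (isFluid-arc (x b) (arc-x b))) sat))

  outgoingPair-split : ∀ {x L w X} (p : Bool → ℚ) → m ℕ.≤ L → splitterFlow L w ≡ X →
    p false + p true ≡ Out.fairShare (L ∸ m) w + Out.fairShare (L ∸ m) w →
    (∀ b → arc (x b) ≡ arcData outputHalf (split X (p b) (p (not b))) (p b)) → OutgoingPair x L w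
  outgoingPair-split {x} p m≤L flow≡X caps arc-x = record
    { sum           = trans P.sum (sym flow≡X)
    ; fluid⇒≥       = λ b flu → P.slack⇒≥ b (slack b flu)
    ; fluid⇒limited = λ b flu → outputSlack m≤L λ tight →
        P.slack⇒≢capacitySum b (slack b flu) (trans (sym flow≡X) (trans tight (sym caps)))
    }
    where
    module P = SplitPair {x} p arc-x
    slack : ∀ b → isFluid (x b) ≡ true → t (x b) ≢ p b
    slack b flu = fluid-output-true (trans (sym (isFluid-arc (x b) (arc-x b))) flu) ∘ trans (sym (P.t-x b))

  outgoingPair-equal : ∀ {x L w a κ} → L ℕ.< m → splitterFlow L w ≡ a + a → κ ≡ In.fairShare (m ∸ L) w →
    (∀ b → arc (x b) ≡ arcData inputHalf a κ) → OutgoingPair x L w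
  outgoingPair-equal {x} {a = a} {κ} L<m flow≡2a κ≡share arc-x = record
    { sum           = trans P.sum (sym flow≡2a)
    ; fluid⇒≥       = λ b _ → P.ordered b
    ; fluid⇒limited = λ b flu → inputTight L<m
        (trans flow≡2a (trans (P.tight b (tight b flu)) (cong (λ y → y + y) κ≡share)))
    }
    where
    module P = EqualPair {x} arc-x
    tight : ∀ b → isFluid (x b) ≡ true → t (x b) ≡ κ
    tight b flu = trans (P.t-x b) (fluid-input-true (trans (sym (isFluid-arc (x b) (arc-x b))) flu))

  incomingPair : ∀ s → IncomingPair (inArc s) (toℕ (proj₁ s)) (bits (proj₂ s))
  incomingPair (fzero , j) = incomingPair-split (λ b → In.terminalCap (b ∷ w)) z≤n
    (splitterFlow-firstHalf w z≤n) (sym (In.fairShare-length-double w))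
    (λ b → cong (λ v → arcData inputHalf (In.terminalLoad v) (In.terminalCap (b ∷ w)))
                (finToBits-bitsToFin (b ∷ w)))
    where
    w : Vec Bool m
    w = bits j
  incomingPair (fsuc l , j) with toℕ l ℕ.<? m
  ... | yes L<m = incomingPair-split (λ b → In.fairShare (suc e) (flipIf b e w)) L<m
                    (splitterFlow-firstHalf w L<m) (sym (prefixMean-double e In.pairCap w)) arc-x
    where
    w : Vec Bool m
    w = bits j
    e : ℕ
    e = m ∸ suc (toℕ l)
    arc-x : ∀ b → arc (midA l (headColumn l j b) b) ≡
            arcData inputHalf (split (In.load e w + In.load e w) (In.fairShare (suc e) (flipIf b e w))
                                                                 (In.fairShare (suc e) (flipIf (not b) e w)))
                              (In.fairShare (suc e) (flipIf b e w))
    arc-x b = begin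
      midData l (headColumn l j b) b                     ≡⟨ midData-firstHalf (headColumn l j b) b L<m ⟩
      inputData (m ∸ toℕ l) (bits (headColumn l j b))    ≡⟨ cong₂ inputData (p∸q≡suc[p∸suc[q]] L<m)
                                                              (trans (bits-headColumn l j b)
                                                                     (cong (λ p → flipIf b p w) (l′-firstHalf L<m))) ⟩
      inputData (suc e) (flipIf b e w)                   ≡⟨ cong₂ (arcData inputHalf)
                                                              (flow-suc-flipIf In.pairCap μ e w b) refl ⟩
      _                                                  ∎
      where open ≡-Reasoning
  ... | no L≮m = incomingPair-equal (s≤s m≤L)
                   (trans (splitterFlow-secondHalf w (ℕₚ.m≤n⇒m≤1+n m≤L))
                          (cong (λ e → Out.load e w + Out.load e w) 1+L∸m))
                   (cong (λ e → Out.fairShare e w) (sym 1+L∸m))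
                   (λ b → trans (midData-secondHalf (headColumn l j b) b m≤L)
                                (cong (outputData (suc d) ∘ bits) (headColumn-involutive l j b)))
    where
    w : Vec Bool m
    w = bits j
    m≤L : m ℕ.≤ toℕ l
    m≤L = ℕₚ.≮⇒≥ L≮m
    d : ℕ
    d = toℕ l ∸ m
    1+L∸m : suc (toℕ l) ∸ m ≡ suc d
    1+L∸m = ℕₚ.+-∸-assoc 1 m≤L

  outgoingPair-last : ∀ j → OutgoingPair (outArc′ ‵fromℕ j) (toℕ (fromℕ (2 ℕ.* m))) (bits j)
  outgoingPair-last j = outgoingPair-split (λ b → Out.terminalCap (b ∷ w)) m≤L
    (trans (splitterFlow-secondHalf w m≤L) (cong (λ e → Out.load e w + Out.load e w) L∸m≡m))
    (trans (sym (Out.fairShare-length-double w))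
           (cong (λ e → Out.fairShare e w + Out.fairShare e w) (sym L∸m≡m)))
    (λ b → cong (λ v → arcData outputHalf (Out.terminalLoad v) (Out.terminalCap (b ∷ w)))
                (finToBits-bitsToFin (b ∷ w)))
    where
    w : Vec Bool m
    w = bits j
    L≡m+m : toℕ (fromℕ (2 ℕ.* m)) ≡ m ℕ.+ m
    L≡m+m = trans (Finₚ.toℕ-fromℕ _) (cong (m ℕ.+_) (ℕₚ.+-identityʳ m))
    m≤L : m ℕ.≤ toℕ (fromℕ (2 ℕ.* m))
    m≤L = subst (m ℕ.≤_) (sym L≡m+m) (ℕₚ.m≤m+n m m)
    L∸m≡m : toℕ (fromℕ (2 ℕ.* m)) ∸ m ≡ m
    L∸m≡m = trans (cong (_∸ m) L≡m+m) (ℕₚ.m+n∸m≡n m m)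

  outgoingPair-mid : ∀ l j → OutgoingPair (midA l j) (toℕ l) (bits j)
  outgoingPair-mid l j with toℕ l ℕ.<? m
  ... | yes L<m = outgoingPair-equal L<m (splitterFlow-firstHalf (bits j) (ℕₚ.<⇒≤ L<m)) refl
                    (λ b → midData-firstHalf j b L<m)
  ... | no L≮m = outgoingPair-split (λ b → Out.fairShare (suc d) (flipIf b d w)) m≤L
                   (splitterFlow-secondHalf w m≤L) (sym (prefixMean-double d Out.pairCap w)) arc-x
    where
    w : Vec Bool m
    w = bits j
    m≤L : m ℕ.≤ toℕ l
    m≤L = ℕₚ.≮⇒≥ L≮m
    d : ℕ
    d = toℕ l ∸ m
    arc-x : ∀ b → arc (midA l j b) ≡
            arcData outputHalf (split (Out.load d w + Out.load d w) (Out.fairShare (suc d) (flipIf b d w))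
                                                                    (Out.fairShare (suc d) (flipIf (not b) d w)))
                               (Out.fairShare (suc d) (flipIf b d w))
    arc-x b = begin
      midData l j b                              ≡⟨ midData-secondHalf j b m≤L ⟩
      outputData (suc d) (bits (headColumn l j b)) ≡⟨ cong (outputData (suc d))
                                                      (trans (bits-headColumn l j b)
                                                             (cong (λ p → flipIf b p w) (l′-secondHalf m≤L))) ⟩
      outputData (suc d) (flipIf b d w)          ≡⟨ cong₂ (arcData outputHalf)
                                                      (flow-suc-flipIf Out.pairCap μ d w b) refl ⟩
      _                                          ∎
      where open ≡-Reasoning

  outgoingPair : ∀ s → OutgoingPair (outArc s) (toℕ (proj₁ s)) (bits (proj₂ s))
  outgoingPair (l , j) = outgoingPair′ (view l)
    where
    outgoingPair′ : ∀ {l} (vl : View l) → OutgoingPair (outArc′ vl j) (toℕ l) (bits j)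
    outgoingPair′ ‵fromℕ       = outgoingPair-last j
    outgoingPair′ (‵inject₁ l) =
      subst (λ L → OutgoingPair (midA l j) L (bits j)) (sym (Finₚ.toℕ-inject₁ l)) (outgoingPair-mid l j)

  capacity : BArc m → ℚ
  capacity e = ArcData.capacity (arc e)

  t-bounds : ∀ e → 0ℚ ≤ t e × t e ≤ capacity e
  t-bounds (inA i)      = subst (λ i′ → 0ℚ ≤ t (inA i) × t (inA i) ≤ cI i′) (bitsToFin-finToBits {suc m} i)
                                (InBounds.terminalLoad-bounds (finToBits (suc m) i))
  t-bounds (outA o)     = subst (λ o′ → 0ℚ ≤ t (outA o) × t (outA o) ≤ cO o′) (bitsToFin-finToBits {suc m} o)
                                (OutBounds.terminalLoad-bounds (finToBits (suc m) o))
  t-bounds (midA l j b) with toℕ l ℕ.<? m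
  ... | yes _ = InBounds.load-bounds (m ∸ toℕ l) (bits j)
  ... | no  _ = OutBounds.load-bounds (suc (toℕ l ∸ m)) (bits (headColumn l j b))

  capacity≤1 : ∀ e → capacity e ≤ 1ℚ
  capacity≤1 (inA i)      = proj₂ (cI∈ i)
  capacity≤1 (outA o)     = proj₂ (cO∈ o)
  capacity≤1 (midA l j b) with toℕ l ℕ.<? m
  ... | yes _ = proj₂ (In.fairShare∈ (m ∸ toℕ l) (bits j))
  ... | no  _ = proj₂ (Out.fairShare∈ (suc (toℕ l ∸ m)) (bits (headColumn l j b)))

  other-of-pair : ∀ (x : Bool → BArc m) {e₁ e₂} → e₁ ≢ e₂ → e₁ ≡ x (slot e₁) → e₂ ≡ x (slot e₂) →
                  e₂ ≡ x (not (slot e₁))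
  other-of-pair x {e₁} {e₂} e₁≢e₂ e₁≡ e₂≡ = trans e₂≡ (cong x (¬-not slot₂≢slot₁))
    where
    slot₂≢slot₁ : slot e₂ ≢ slot e₁
    slot₂≢slot₁ eq = e₁≢e₂ (trans e₁≡ (trans (cong x (sym eq)) (sym e₂≡)))

  pair-≤ : ∀ (x : Bool → BArc m) β → (∀ b → isFluid (x b) ≡ β → t (x (not b)) ≤ t (x b)) →
           ∀ {e₁ e₂} → e₁ ≢ e₂ → e₁ ≡ x (slot e₁) → e₂ ≡ x (slot e₂) → isFluid e₁ ≡ β → t e₂ ≤ t e₁
  pair-≤ x β ordered {e₁} {e₂} e₁≢e₂ e₁≡ e₂≡ flag =
    subst₂ _≤_ (cong t (sym (other-of-pair x e₁≢e₂ e₁≡ e₂≡))) (cong t (sym e₁≡))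
           (ordered (slot e₁) (trans (cong isFluid (sym e₁≡)) flag))

  ¬saturatedIn∧fluidOut : ∀ s e₁ e₂ → bhead e₁ ≡ spl s → btail e₂ ≡ spl s →
                          isFluid e₁ ≡ false → isFluid e₂ ≡ true → ⊥
  ¬saturatedIn∧fluidOut s e₁ e₂ h₁ h₂ sat flu =
    IncomingPair.saturated⇒¬limited (incomingPair s) (slot e₁)
      (trans (cong isFluid (sym (bhead≡spl⇒inArc e₁ s h₁))) sat)
      (OutgoingPair.fluid⇒limited (outgoingPair s) (slot e₂)
        (trans (cong isFluid (sym (btail≡spl⇒outArc e₂ s h₂))) flu))

  steadyState : SteadyState N cI cO t isFluid
  steadyState = record
    { range = λ e → proj₁ (t-bounds e) , ≤-trans (proj₂ (t-bounds e)) (capacity≤1 e)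
    ; R3    = R3
    ; R4    = R4
    ; R5    = λ s → begin
        inFlow N t s                                   ≡⟨ inFlow-inArc t s ⟩
        t (inArc s false) + t (inArc s true)           ≡⟨ IncomingPair.sum (incomingPair s) ⟩
        splitterFlow (toℕ (proj₁ s)) (bits (proj₂ s))  ≡⟨ OutgoingPair.sum (outgoingPair s) ⟨
        t (outArc s false) + t (outArc s true)         ≡⟨ outFlow-outArc t s ⟨
        outFlow N t s                                  ∎
    ; R6    = λ s e₁ e₂ e₁≢e₂ h₁ h₂ → pair-≤ (inArc s) false (IncomingPair.saturated⇒≥ (incomingPair s))
                                        e₁≢e₂ (bhead≡spl⇒inArc e₁ s h₁) (bhead≡spl⇒inArc e₂ s h₂)
    ; R7    = λ s e₁ e₂ e₁≢e₂ h₁ h₂ → pair-≤ (outArc s) true (OutgoingPair.fluid⇒≥ (outgoingPair s))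
                                        e₁≢e₂ (btail≡spl⇒outArc e₁ s h₁) (btail≡spl⇒outArc e₂ s h₂)
    ; R8    = R8
    }
    where
    open ≡-Reasoning
    R3 : ∀ i e → btail e ≡ inp i → t e ≤ cI i × (isFluid e ≡ true → t e ≡ cI i)
    R3 i (inA .i) refl = proj₂ (t-bounds (inA i)) , fluid-input-true
    R4 : ∀ o e → bhead e ≡ out o → t e ≤ cO o × (isFluid e ≡ false → t e ≡ cO o)
    R4 o e h with bhead≡out⇒outA e o h
    ... | refl = proj₂ (t-bounds (outA o)) , fluid-output-false
    R8 : ∀ e₁ e₂ → bhead e₁ ≡ btail e₂ → isFluid e₁ ≡ false → isFluid e₂ ≡ true → t e₁ ≡ 1ℚ ⊎ t e₂ ≡ 1ℚ
    R8 e₁ (inA i)      h _   _   = contradiction h (bhead≢inp e₁ i)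
    R8 e₁ (outA o)     h sat flu = ⊥-elim (¬saturatedIn∧fluidOut _ e₁ (outA o) h refl sat flu)
    R8 e₁ (midA l j b) h sat flu = ⊥-elim (¬saturatedIn∧fluidOut _ e₁ (midA l j b) h refl sat flu)

  throughput≡min : throughput N t ≡ sumℚ (map cI (allFin _)) ⊓ sumℚ (map cO (allFin _))
  throughput≡min = begin
    throughput N t                                     ≡⟨ throughput-inA t ⟩
    ∑Fin (2 ^ suc m) (t ∘ inA)                         ≡⟨ ∑Fin≡cubeSum (suc m) (t ∘ inA) ⟩
    cubeSum {suc m} (In.terminalLoad ∘ finToBits (suc m) ∘ bitsToFin)
                                                       ≡⟨ cubeSum-cong {suc m} (cong In.terminalLoad ∘ finToBits-bitsToFin) ⟩
    cubeSum In.terminalLoad                            ≡⟨ In.cubeSum-terminalLoad ⟩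
    cubeSum {m} (λ _ → μ) + cubeSum {m} (λ _ → μ)      ≡⟨ cong (λ s → s + s) (trans (cubeSum-cong {m} (λ _ → μ≡½^*½M))
                                                                                    (cubeSum-½^-const m (½ * M))) ⟩
    ½ * M + ½ * M                                      ≡⟨ ½*p+½*p≡p M ⟩
    M                                                  ≡⟨ cong₂ _⊓_ (sumℚ-map-allFin _ cI) (sumℚ-map-allFin _ cO) ⟨
    sumℚ (map cI (allFin _)) ⊓ sumℚ (map cO (allFin _)) ∎
    where
    open ≡-Reasoning
    μ≡½^*½M : μ ≡ ½^ m * (½ * M)
    μ≡½^*½M = solve 2 (λ x y → con ½ :* x :* y := x :* (con ½ :* y)) refl (½^ m) M

  outputs-constant : (∀ o → cO o ≡ 1ℚ) → ∀ e e′ o o′ → bhead e ≡ out o → bhead e′ ≡ out o′ → t e ≡ t e′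
  outputs-constant cO≡1 e e′ o o′ h h′ rewrite bhead≡out⇒outA e o h | bhead≡out⇒outA e′ o′ h′ =
    trans (terminalLoad≡μ (finToBits (suc m) o)) (sym (terminalLoad≡μ (finToBits (suc m) o′)))
    where open Out.AllOne cO≡1

open import Data.Nat using (_≤_; z≤n; s≤s)
open import Data.Product using (_,_)
open import Data.Rational using (1ℚ)
open import Relation.Binary.PropositionalEquality using (refl)

benes-balancer : ∀ m → Balancer (Benes (suc m) (s≤s z≤n))
benes-balancer m cI (cI∈ , 1∈) = t , isFluid , steadyState , outputs-constant (λ _ → refl)
  where open SteadyStateConstruction m cI (λ _ → 1ℚ) cI∈ 1∈

proposition4 : ∀ (k : ℕ) (1≤k : 1 ≤ k) → ThroughputUnlimited (Benes k 1≤k)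
proposition4 (suc m) (s≤s z≤n) = benes-balancer m , λ cI cO (cI∈ , cO∈) →
  let open SteadyStateConstruction m cI cO cI∈ cO∈ in t , isFluid , steadyState , throughput≡min
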